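{- Let $q$ be a power of a prime $p$, $a\in\mathbb{F}_q$, $s$ an integer with $1<s<q$, $\bar{s}=q-s$, and let $d_{2,m,n}$ ($m,n\in\mathbb{N}^*$) be as defined in the context. Then: for $n=1$ (and all $m\in\mathbb{N}^*$), $d_{2,m,n}=\binom{s}{s-1}(-a)^{(s-1)+(m+1-n)s}(-1)^{(s-1)(m-n)}(-1)^{n-1}$; for $2\leq n\leq\bar{s}$, $d_{2,m,n}=0$ for all $m\in\mathbb{N}^*$; for $\bar{s}+1\leq n\leq q$, $d_{2,m,n}=0$ if $m<n-1$ and $d_{2,m,n}=\binom{s}{n-1-\bar{s}}(-a)^{(n-1-\bar{s})+(m+1-n)s}(-1)^{(s-1)(m-n)}(-1)^{n-1}$ if $m\geq n-1$; for $n=q+1$, $d_{2,m,n}=0$ if $m<n-2$ and $d_{2,m,n}=(-a)^{(m+2-n)s}(-1)^{(s-1)(m-n)}(-1)^{n-1}$ if $m\geq n-2$; for $n>q+1$, $d_{2,m,n}=0$ for all $m\in\mathbb{N}^*$.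
   Context: Convention $0^0=1$ in $\mathbb{F}_q$. For a word $w$ over $\{0,\dots,q-1\}$, $[w]_q$ is the integer whose base-$q$ expansion is $w$, and $x^m$ denotes $m$ copies of the letter $x$ (so $[1^00]_q=0$). Decomposition procedure: given a positive integer $b$, set $b_1=b$. Inductively, if $b_i$ has been defined and $b_i\ge q-1$, let $l_i=\max\{l\in\mathbb{N}^*: b_i\geq q^l-1\}$; if $b_i-(q^{l_i}-1)>[1^{l_i-1}0]_q$ the procedure stops, otherwise set $b_{i+1}=b_i-(q^{l_i}-1)$ and continue. If $b_i<q-1$ the procedure stops. For $j,m\in\mathbb{N}^*$, $b_{j,m,n}$ is the term $b_n$ produced with input $b_1=[1^m0^j]_q$ (undefined if the procedure stops before producing $b_n$). When $b_{j,m,n}$ is defined and there is $k\in\mathbb{N}$ with $[\bar{s}^k]_q\le b_{j,m,n}\le[1^k0]_q$, set $k_{j,m,n}=k$ and $c_{j,m,n}=b_{j,m,n}-[\bar{s}^{k}]_q$, and define $d_{j,m,n}=(-1)^{k_{j,m,n}(s-1)}\binom{[s^{k_{j,m,n}}]_q}{c_{j,m,n}}(-a)^{c_{j,m,n}}(-1)^{n-1}\in\mathbb{F}_q$ (binomial coefficient taken mod $p$); otherwise $d_{j,m,n}=0$. -}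

module Defs where

open import Level using (Level; _⊔_)
open import Data.Bool using (Bool; true; false; if_then_else_)
open import Data.Nat using (ℕ; zero; suc; _+_; _*_; _∸_; _^_; _≤ᵇ_; _<ᵇ_)
open import Data.Nat.Combinatorics using (_C_)
open import Data.List using (List; []; _∷_; _++_; replicate; foldl)
open import Data.Maybe using (Maybe; just; nothing; _>>=_)
open import Data.Fin using (Fin)
open import Data.Product using (∃)
open import Relation.Nullary using (¬_)
open import Relation.Binary.PropositionalEquality using (_≡_)
open import Algebra.Bundles using (CommutativeRing)
import Algebra.Bundles
import Algebra.Definitions.RawSemiring as RS

-- Base-q words.  [w]_q : value of the word w (most significant digit first)

wordVal : ℕ → List ℕ → ℕ
wordVal q = foldl (λ acc d → acc * q + d) 0

rep : ℕ → ℕ → List ℕ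
rep x m = replicate m x

ones0 : ℕ → ℕ → ℕ
ones0 q k = wordVal q (rep 1 k ++ (0 ∷ []))

onesZeros : ℕ → ℕ → ℕ → ℕ
onesZeros q m j = wordVal q (rep 1 m ++ rep 0 j)

-- largest l with 1 ≤ l ≤ N and P l (0 if none)
maxUpTo : (ℕ → Bool) → ℕ → ℕ
maxUpTo P zero    = zero
maxUpTo P (suc N) = if P (suc N) then suc N else maxUpTo P N

firstUpTo : (ℕ → Bool) → ℕ → Maybe ℕ
firstUpTo P zero    = if P zero then just zero else nothing
firstUpTo P (suc N) with firstUpTo P N
... | just k  = just k
... | nothing = if P (suc N) then just (suc N) else nothing

-- l_i = max { l ∈ ℕ* : b ≥ q^l - 1 }.  For q ≥ 2 one has q^l - 1 ≥ l,
-- so every such l is ≤ b and the search over 1..b is exhaustive.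
lOf : ℕ → ℕ → ℕ
lOf q b = maxUpTo (λ l → (q ^ l ∸ 1) ≤ᵇ b) b

step : ℕ → ℕ → Maybe ℕ
step q b =
  if b <ᵇ (q ∸ 1) then nothing
  else (let l = lOf q b
            r = b ∸ (q ^ l ∸ 1)
        in if ones0 q (l ∸ 1) <ᵇ r then nothing else just r)

-- bIter q b i = b_{i+1} (if defined), with b_1 = b
bIter : ℕ → ℕ → ℕ → Maybe ℕ
bIter q b zero    = just b
bIter q b (suc i) = bIter q b i >>= step q

-- bTerm q b n = b_n, for n ∈ ℕ*  (n = 0 : undefined)
bTerm : ℕ → ℕ → ℕ → Maybe ℕ
bTerm q b zero    = nothing
bTerm q b (suc i) = bIter q b i

bjmn : ℕ → ℕ → ℕ → ℕ → Maybe ℕ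
bjmn q j m n = bTerm q (onesZeros q m j) n

-- the k ∈ ℕ with [sbar^k]_q ≤ b ≤ [1^k 0]_q, if any.  (Such k is unique
-- when sbar ≥ 1, and satisfies k ≤ [sbar^k]_q ≤ b, so searching k ≤ b
-- is exhaustive.)
kOf : ℕ → ℕ → ℕ → Maybe ℕ
kOf q sbar b =
  firstUpTo (λ k → (wordVal q (rep sbar k) ≤ᵇ b) Data.Bool.∧ (b ≤ᵇ ones0 q k)) b

module _ {c ℓ : Level} (F : CommutativeRing c ℓ) where
  open CommutativeRing F using (Carrier; _≈_; 0#; 1#; -_; semiring) renaming (_*_ to _·_)
  private module R = RS (Algebra.Bundles.Semiring.rawSemiring semiring)

  powF : Carrier → ℕ → Carrier
  powF x n = x R.^ n

  natF : ℕ → Carrier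
  natF n = n R.× 1#

  minusOne : Carrier
  minusOne = - 1#

  record IsFiniteFieldOfOrder (q : ℕ) : Set (c ⊔ ℓ) where
    field
      zero≉one        : ¬ (0# ≈ 1#)
      inverse         : ∀ x → ¬ (x ≈ 0#) → ∃ λ y → x · y ≈ 1#
      enum            : Fin q → Carrier
      enum-injective  : ∀ i j → enum i ≈ enum j → i ≡ j
      enum-surjective : ∀ x → ∃ λ i → enum i ≈ x

  dF : ℕ → ℕ → Carrier → ℕ → ℕ → ℕ → Carrier
  dF q s a j m n with bjmn q j m n
  ... | nothing = 0#
  ... | just b with kOf q (q ∸ s) b
  ...   | nothing = 0#
  ...   | just k =
          let cc = b ∸ wordVal q (rep (q ∸ s) k) in
          powF minusOne (k * (s ∸ 1))
            · (natF (wordVal q (rep s k) C cc)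
            · (powF (- a) cc
            · powF minusOne (n ∸ 1)))

-- Field notation used in the statement, with names that do not clash
-- with the ℕ operators
module FieldNotation {c ℓ : Level} (F : CommutativeRing c ℓ) where
  infixl 7 _·_
  infix 4 _≃_
  _·_ : CommutativeRing.Carrier F → CommutativeRing.Carrier F → CommutativeRing.Carrier F
  _·_ = CommutativeRing._*_ F
  _≃_ : CommutativeRing.Carrier F → CommutativeRing.Carrier F → Set ℓ
  _≃_ = CommutativeRing._≈_ F
  0ᶠ : CommutativeRing.Carrier F
  0ᶠ = CommutativeRing.0# F
  negᶠ : CommutativeRing.Carrier F → CommutativeRing.Carrier F
  negᶠ = CommutativeRing.-_ F

module Submission where

open import Defs
open import Level using (Level)
open import Data.Nat using (ℕ; _+_; _*_; _∸_; _^_; _≤_; _<_; ∣_-_∣)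
open import Data.Nat.Primality using (Prime)
open import Data.Nat.Combinatorics using (_C_)
open import Data.Product using (_×_; _,_)
open import Algebra.Bundles using (CommutativeRing)

-- Started at b_1 = [1^m 0 0]_q, the decomposition procedure runs through
-- b_{i+1} = [1^(m-i) 0 0]_q + i for i ≤ min(m, q), the step from b_{i+1}
-- subtracting q^(m-i+1) - 1; afterwards it stops within one step, except
-- that it passes through 0 when m = q - 1.  A term [1^(j+1) 0 0]_q + t (t ≤ q) lies in the
-- window k = j + 2, a single digit t ≥ sbar in window 1, and 0 in window 0.
-- In window j + 2 both the top word [s^(j+2)]_q and the excess
-- c = b - [sbar^(j+2)]_q have explicit base-q digits, so Lucas' theorem
-- (valid in characteristic p for q = p^e) evaluates C([s^k]_q, c), and
-- x^q = x in F collapses (-a)^c to the stated power of -a.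

module Decomposition where

  open import Data.Bool using (Bool; true; false; T; _∧_; if_then_else_)
  open import Data.Bool.Properties using (∧-zeroʳ)
  open import Data.Empty using (⊥-elim)
  open import Data.List using ([]; _∷_; _++_)
  open import Data.List.Properties using (foldl-++)
  open import Data.Maybe using (just; nothing)
  open import Data.Nat
  open import Data.Nat.Properties
  open import Data.Nat.Tactic.RingSolver using (solve-∀)
  open import Data.Unit using (tt)
  open import Relation.Nullary using (yes; no)
  open import Relation.Binary.PropositionalEquality

  ≤ᵇ-true : ∀ {m n} → m ≤ n → (m ≤ᵇ n) ≡ true
  ≤ᵇ-true {m} {n} m≤n with m ≤ᵇ n | ≤⇒≤ᵇ m≤n
  ... | true | _ = refl

  ≤ᵇ-false : ∀ {m n} → n < m → (m ≤ᵇ n) ≡ false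
  ≤ᵇ-false {m} {n} n<m with m ≤ᵇ n in eq
  ... | false = refl
  ... | true = ⊥-elim (<⇒≱ n<m (≤ᵇ⇒≤ m n (subst T (sym eq) tt)))

  <ᵇ-true : ∀ {m n} → m < n → (m <ᵇ n) ≡ true
  <ᵇ-true {m} {n} m<n with m <ᵇ n | <⇒<ᵇ m<n
  ... | true | _ = refl

  <ᵇ-false : ∀ {m n} → n ≤ m → (m <ᵇ n) ≡ false
  <ᵇ-false {m} {n} n≤m with m <ᵇ n in eq
  ... | false = refl
  ... | true = ⊥-elim (≤⇒≯ n≤m (<ᵇ⇒< m n (subst T (sym eq) tt)))

  m∸n≡suc[m∸1+n] : ∀ {m n} → n < m → m ∸ n ≡ suc (m ∸ suc n)
  m∸n≡suc[m∸1+n] {suc m} {zero} _ = refl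
  m∸n≡suc[m∸1+n] {suc m} {suc n} n<m = m∸n≡suc[m∸1+n] (s≤s⁻¹ n<m)

  maxUpTo-≡ : ∀ (P : ℕ → Bool) N L → L ≤ N → P L ≡ true →
              (∀ l → L < l → l ≤ N → P l ≡ false) → maxUpTo P N ≡ L
  maxUpTo-≡ P zero .zero z≤n _ _ = refl
  maxUpTo-≡ P (suc N) L L≤N PL above with L ≟ suc N
  ... | yes refl rewrite PL = refl
  ... | no L≢N rewrite above (suc N) (≤∧≢⇒< L≤N L≢N) ≤-refl =
        maxUpTo-≡ P N L (s≤s⁻¹ (≤∧≢⇒< L≤N L≢N)) PL (λ l L<l l≤N → above l L<l (m≤n⇒m≤1+n l≤N))

  firstUpTo-nothing : ∀ (P : ℕ → Bool) N → (∀ k → k ≤ N → P k ≡ false) → firstUpTo P N ≡ nothing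
  firstUpTo-nothing P zero none rewrite none 0 z≤n = refl
  firstUpTo-nothing P (suc N) none
    rewrite firstUpTo-nothing P N (λ k k≤N → none k (m≤n⇒m≤1+n k≤N)) | none (suc N) ≤-refl = refl

  firstUpTo-just : ∀ (P : ℕ → Bool) N K → K ≤ N → P K ≡ true →
                   (∀ k → k < K → P k ≡ false) → firstUpTo P N ≡ just K
  firstUpTo-just P zero .zero z≤n PK _ rewrite PK = refl
  firstUpTo-just P (suc N) K K≤N PK below with K ≟ suc N
  ... | yes refl rewrite firstUpTo-nothing P N (λ k k≤N → below k (s≤s k≤N)) | PK = refl
  ... | no K≢N rewrite firstUpTo-just P N K (s≤s⁻¹ (≤∧≢⇒< K≤N K≢N)) PK below = refl

  -- Values of base-q words.  All words that occur are repdigits x^k,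
  -- whose value is x times the repunit [1^k]_q.

  repunit : ℕ → ℕ → ℕ
  repunit q k = wordVal q (rep 1 k)

  rep-value-suc : ∀ q x k → wordVal q (rep x (suc k)) ≡ wordVal q (rep x k) * q + x
  rep-value-suc q x k = begin
    wordVal q (rep x (suc k))      ≡⟨ cong (wordVal q) (rep-snoc k) ⟩
    wordVal q (rep x k ++ x ∷ [])  ≡⟨ foldl-++ (λ acc d → acc * q + d) 0 (rep x k) (x ∷ []) ⟩
    wordVal q (rep x k) * q + x    ∎
    where
    open ≡-Reasoning
    rep-snoc : ∀ k → rep x (suc k) ≡ rep x k ++ x ∷ []
    rep-snoc zero    = refl
    rep-snoc (suc k) = cong (x ∷_) (rep-snoc k)

  repdigit-value : ∀ q x k → wordVal q (rep x k) ≡ x * repunit q k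
  repdigit-value q x zero = sym (*-zeroʳ x)
  repdigit-value q x (suc k)
    rewrite rep-value-suc q x k | rep-value-suc q 1 k | repdigit-value q x k = distrib x (repunit q k) q
    where
    distrib : ∀ x r q → x * r * q + x ≡ x * (r * q + 1)
    distrib = solve-∀

  ones0-value : ∀ q k → ones0 q k ≡ repunit q k * q
  ones0-value q k = trans (foldl-++ (λ acc d → acc * q + d) 0 (rep 1 k) (0 ∷ [])) (+-identityʳ _)

  -- The numbers [1^j 0 0]_q + t.  The procedure started at [1^m 0 0]_q
  -- runs through such numbers, t counting the steps taken.

  ones00 : ℕ → ℕ → ℕ → ℕ
  ones00 q j t = repunit q j * q * q + t

  onesZeros-value : ∀ q m → onesZeros q m 2 ≡ ones00 q m 0
  onesZeros-value q m rewrite foldl-++ (λ acc d → acc * q + d) 0 (rep 1 m) (0 ∷ 0 ∷ []) =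
    shift (repunit q m) q
    where
    shift : ∀ x q → (x * q + 0) * q + 0 ≡ x * q * q + 0
    shift = solve-∀

  bIter-stopped : ∀ q b {i k} → bIter q b i ≡ nothing → i ≤ k → bIter q b k ≡ nothing
  bIter-stopped q b {i} stopped i≤k = go (≤⇒≤′ i≤k)
    where
    go : ∀ {k} → i ≤′ k → bIter q b k ≡ nothing
    go ≤′-refl = stopped
    go (≤′-step i≤′k) rewrite go i≤′k = refl

  module InBase (q : ℕ) (2≤q : 2 ≤ q) where
    open ≤-Reasoning

    1≤q : 1 ≤ q
    1≤q = ≤-trans (s≤s z≤n) 2≤q

    repunit-suc : ∀ k → repunit q (suc k) ≡ repunit q k * q + 1
    repunit-suc = rep-value-suc q 1

    repunit-suc-lead : ∀ k → repunit q (suc k) ≡ q ^ k + repunit q k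
    repunit-suc-lead zero = refl
    repunit-suc-lead (suc k) = begin-equality
      repunit q (suc (suc k))            ≡⟨ repunit-suc (suc k) ⟩
      repunit q (suc k) * q + 1          ≡⟨ cong (λ r → r * q + 1) (repunit-suc-lead k) ⟩
      (q ^ k + repunit q k) * q + 1      ≡⟨ regroup (q ^ k) (repunit q k) q ⟩
      q * q ^ k + (repunit q k * q + 1)  ≡⟨ cong (q * q ^ k +_) (repunit-suc k) ⟨
      q ^ suc k + repunit q (suc k)      ∎
      where
      regroup : ∀ a b q → (a + b) * q + 1 ≡ q * a + (b * q + 1)
      regroup = solve-∀

    n≤n*q : ∀ n → n ≤ n * q
    n≤n*q n = begin n ≡⟨ *-identityʳ n ⟨ n * 1 ≤⟨ *-monoʳ-≤ n 1≤q ⟩ n * q ∎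

    n<n*q : ∀ {n} → 1 ≤ n → n < n * q
    n<n*q {n} 1≤n = begin-strict
      n      <⟨ m<m+n n 1≤n ⟩
      n + n  ≡⟨ cong (n +_) (+-identityʳ n) ⟨
      2 * n  ≤⟨ *-monoˡ-≤ n 2≤q ⟩
      q * n  ≡⟨ *-comm q n ⟩
      n * q  ∎

    repunit-mono : ∀ {j k} → j ≤ k → repunit q j ≤ repunit q k
    repunit-mono {k = zero} z≤n = ≤-refl
    repunit-mono {j} {suc k} j≤k with j ≟ suc k
    ... | yes refl = ≤-refl
    ... | no j≢k = begin
      repunit q j          ≤⟨ repunit-mono (s≤s⁻¹ (≤∧≢⇒< j≤k j≢k)) ⟩
      repunit q k          ≤⟨ n≤n*q _ ⟩
      repunit q k * q      ≤⟨ m≤m+n _ 1 ⟩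
      repunit q k * q + 1  ≡⟨ repunit-suc k ⟨
      repunit q (suc k)    ∎

    k≤repunit : ∀ k → k ≤ repunit q k
    k≤repunit zero = z≤n
    k≤repunit (suc k) = begin
      suc k                  ≤⟨ s≤s (k≤repunit k) ⟩
      suc (repunit q k)      ≤⟨ s≤s (n≤n*q _) ⟩
      suc (repunit q k * q)  ≡⟨ +-comm 1 _ ⟩
      repunit q k * q + 1    ≡⟨ repunit-suc k ⟨
      repunit q (suc k)      ∎

    1≤repunit : ∀ k → 1 ≤ repunit q (suc k)
    1≤repunit k = ≤-trans (s≤s z≤n) (k≤repunit (suc k))

    pow≤repunit : ∀ k → q ^ k ≤ repunit q (suc k)
    pow≤repunit k = begin
      q ^ k                ≤⟨ m≤m+n (q ^ k) _ ⟩
      q ^ k + repunit q k  ≡⟨ repunit-suc-lead k ⟨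
      repunit q (suc k)    ∎

    repunit<pow : ∀ k → repunit q k < q ^ k
    repunit<pow zero = z<s
    repunit<pow (suc k) = begin-strict
      repunit q (suc k)      ≡⟨ repunit-suc k ⟩
      repunit q k * q + 1    <⟨ +-monoʳ-< (repunit q k * q) 2≤q ⟩
      repunit q k * q + q    ≡⟨ +-comm (repunit q k * q) q ⟩
      suc (repunit q k) * q  ≤⟨ *-monoˡ-≤ q (repunit<pow k) ⟩
      q ^ k * q              ≡⟨ *-comm (q ^ k) q ⟩
      q ^ suc k              ∎

    q+2≤q*q : q + 2 ≤ q * q
    q+2≤q*q = begin
      q + 2  ≤⟨ +-monoʳ-≤ q 2≤q ⟩
      q + q  ≡⟨ cong (q +_) (+-identityʳ q) ⟨
      2 * q  ≤⟨ *-monoˡ-≤ q 2≤q ⟩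
      q * q  ∎

    repunit≤ones00 : ∀ j t → repunit q (suc (suc j)) ≤ ones00 q (suc j) t
    repunit≤ones00 j t = begin
      repunit q (suc (suc j))  ≡⟨ repunit-suc (suc j) ⟩
      X * q + 1                ≡⟨ +-comm (X * q) 1 ⟩
      suc (X * q)              ≤⟨ n<n*q (*-mono-≤ (1≤repunit j) 1≤q) ⟩
      X * q * q                ≤⟨ m≤m+n _ t ⟩
      ones00 q (suc j) t       ∎
      where
      X : ℕ
      X = repunit q (suc j)

    instance
      q-nonZero : NonZero q
      q-nonZero = >-nonZero 1≤q

    lOf-≡ : ∀ b L → L ≤ b → q ^ L ≤ suc b → b + 2 ≤ q ^ suc L → lOf q b ≡ L
    lOf-≡ b L L≤b lower upper =
      maxUpTo-≡ (λ l → (q ^ l ∸ 1) ≤ᵇ b) b L L≤b (≤ᵇ-true (∸-monoˡ-≤ 1 lower)) too-big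
      where
      too-big : ∀ l → L < l → l ≤ b → ((q ^ l ∸ 1) ≤ᵇ b) ≡ false
      too-big l L<l _ = ≤ᵇ-false (m+n≤o⇒m≤o∸n (suc b) (begin
        suc b + 1  ≡⟨ +-suc b 1 ⟨
        b + 2      ≤⟨ upper ⟩
        q ^ suc L  ≤⟨ ^-monoʳ-≤ q L<l ⟩
        q ^ l      ∎))

    lOf-ones00 : ∀ j t → t ≤ q → lOf q (ones00 q (suc j) t) ≡ suc (suc j)
    lOf-ones00 j t t≤q = lOf-≡ b (suc (suc j))
      (≤-trans (k≤repunit (suc (suc j))) (repunit≤ones00 j t)) lower upper
      where
      X : ℕ
      X = repunit q (suc j)
      b : ℕ
      b = ones00 q (suc j) t
      lower : q ^ suc (suc j) ≤ suc b
      lower = begin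
        q * (q * q ^ j)  ≤⟨ *-monoʳ-≤ q (*-monoʳ-≤ q (pow≤repunit j)) ⟩
        q * (q * X)      ≡⟨ swap q X ⟩
        X * q * q        ≤⟨ m≤m+n _ t ⟩
        b                ≤⟨ n≤1+n b ⟩
        suc b            ∎
        where
        swap : ∀ q X → q * (q * X) ≡ X * q * q
        swap = solve-∀
      upper : b + 2 ≤ q ^ suc (suc (suc j))
      upper = begin
        X * q * q + t + 2    ≤⟨ +-monoˡ-≤ 2 (+-monoʳ-≤ (X * q * q) t≤q) ⟩
        X * q * q + q + 2    ≡⟨ +-assoc (X * q * q) q 2 ⟩
        X * q * q + (q + 2)  ≤⟨ +-monoʳ-≤ (X * q * q) q+2≤q*q ⟩
        X * q * q + q * q    ≡⟨ factor X q ⟩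
        q * (q * suc X)      ≤⟨ *-monoʳ-≤ q (*-monoʳ-≤ q (repunit<pow (suc j))) ⟩
        q * (q * q ^ suc j)  ∎
        where
        factor : ∀ X q → X * q * q + q * q ≡ q * (q * (1 + X))
        factor = solve-∀

    lOf-small : ∀ t → q ∸ 1 ≤ t → t ≤ q → lOf q t ≡ 1
    lOf-small t q-1≤t t≤q = lOf-≡ t 1 (≤-trans (∸-monoˡ-≤ 1 2≤q) q-1≤t) lower upper
      where
      lower : q ^ 1 ≤ suc t
      lower = begin
        q * 1        ≡⟨ *-identityʳ q ⟩
        q            ≤⟨ m≤n+m∸n q 1 ⟩
        suc (q ∸ 1)  ≤⟨ s≤s q-1≤t ⟩
        suc t        ∎
      upper : t + 2 ≤ q ^ 2
      upper = begin
        t + 2        ≤⟨ +-monoˡ-≤ 2 t≤q ⟩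
        q + 2        ≤⟨ q+2≤q*q ⟩
        q * q        ≡⟨ cong (q *_) (*-identityʳ q) ⟨
        q * (q * 1)  ∎

    step-unfold : ∀ b L → q ∸ 1 ≤ b → lOf q b ≡ L →
                  step q b ≡ (if ones0 q (L ∸ 1) <ᵇ (b ∸ (q ^ L ∸ 1)) then nothing else just (b ∸ (q ^ L ∸ 1)))
    step-unfold b L q-1≤b lOf≡L rewrite <ᵇ-false q-1≤b | lOf≡L = refl

    ones00-minus : ∀ j t → ones00 q (suc j) t ∸ (q ^ suc (suc j) ∸ 1) ≡ ones00 q j (suc t)
    ones00-minus j t = begin-equality
      ones00 q (suc j) t ∸ y                 ≡⟨ cong (λ r → r * q * q + t ∸ y) (repunit-suc-lead j) ⟩
      (q ^ j + repunit q j) * q * q + t ∸ y  ≡⟨ cong (_∸ y) (split (q ^ j) (repunit q j) q t) ⟩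
      q ^ suc (suc j) + (ones00 q j t) ∸ y   ≡⟨ cong (λ z → z + ones00 q j t ∸ y) (m∸n+n≡m pow≥1) ⟨
      (y + 1) + ones00 q j t ∸ y             ≡⟨ cong (_∸ y) (shift y (repunit q j * q * q) t) ⟩
      y + ones00 q j (suc t) ∸ y             ≡⟨ m+n∸m≡n y _ ⟩
      ones00 q j (suc t)                     ∎
      where
      y : ℕ
      y = q ^ suc (suc j) ∸ 1
      pow≥1 : 1 ≤ q ^ suc (suc j)
      pow≥1 = m^n>0 q (suc (suc j))
      split : ∀ a b q t → (a + b) * q * q + t ≡ q * (q * a) + (b * q * q + t)
      split = solve-∀
      shift : ∀ y a t → (y + 1) + (a + t) ≡ y + (a + suc t)
      shift = solve-∀

    ones0-suc : ∀ j → ones0 q (suc j) ≡ ones00 q j q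
    ones0-suc j = begin-equality
      ones0 q (suc j)            ≡⟨ ones0-value q (suc j) ⟩
      repunit q (suc j) * q      ≡⟨ cong (_* q) (repunit-suc j) ⟩
      (repunit q j * q + 1) * q  ≡⟨ expand (repunit q j) q ⟩
      ones00 q j q               ∎
      where
      expand : ∀ a q → (a * q + 1) * q ≡ a * q * q + q
      expand = solve-∀

    -- Such terms are never below q - 1, so the procedure does not stop early there.
    q≤ones00 : ∀ j t → q ≤ ones00 q (suc j) t
    q≤ones00 j t = begin
      q                          ≡⟨ *-identityˡ q ⟨
      1 * q                      ≤⟨ *-monoˡ-≤ q (1≤repunit j) ⟩
      repunit q (suc j) * q      ≤⟨ n≤n*q _ ⟩
      repunit q (suc j) * q * q  ≤⟨ m≤m+n _ t ⟩
      ones00 q (suc j) t         ∎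

    step-ones00 : ∀ j t → t < q → step q (ones00 q (suc j) t) ≡ just (ones00 q j (suc t))
    step-ones00 j t t<q
      rewrite step-unfold _ (suc (suc j)) (≤-trans (m∸n≤m q 1) (q≤ones00 j t)) (lOf-ones00 j t (<⇒≤ t<q))
            | ones00-minus j t | ones0-suc j | <ᵇ-false (+-monoʳ-≤ (repunit q j * q * q) t<q) = refl

    step-at-q : ∀ j → step q (ones00 q j q) ≡ nothing
    step-at-q zero
      rewrite step-unfold q 1 (m∸n≤m q 1) (lOf-small q (m∸n≤m q 1) ≤-refl)
            | *-identityʳ q | m∸[m∸n]≡n 1≤q = refl
    step-at-q (suc j)
      rewrite step-unfold _ (suc (suc j)) (≤-trans (m∸n≤m q 1) (q≤ones00 j q)) (lOf-ones00 j q ≤-refl)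
            | ones00-minus j q | ones0-suc j | <ᵇ-true (+-monoʳ-< (repunit q j * q * q) (n<1+n q)) = refl

    step-below : ∀ t → t < q ∸ 1 → step q t ≡ nothing
    step-below t t<q-1 rewrite <ᵇ-true t<q-1 = refl

    step-q-1 : step q (q ∸ 1) ≡ just 0
    step-q-1
      rewrite step-unfold (q ∸ 1) 1 ≤-refl (lOf-small (q ∸ 1) ≤-refl (m∸n≤m q 1))
            | *-identityʳ q | n∸n≡0 (q ∸ 1) = refl

    module Trajectory (m : ℕ) where

      term : ∀ i → i ≤ m → i ≤ q → bjmn q 2 m (suc i) ≡ just (ones00 q (m ∸ i) i)
      term zero _ _ = cong just (onesZeros-value q m)
      term (suc i) i<m i<q rewrite term i (<⇒≤ i<m) (<⇒≤ i<q) | m∸n≡suc[m∸1+n] i<m =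
        step-ones00 (m ∸ suc i) i i<q

      term-before : ∀ i → i < m → i ≤ q → bjmn q 2 m (suc i) ≡ just (ones00 q (suc (m ∸ suc i)) i)
      term-before i i<m i≤q =
        trans (term i (<⇒≤ i<m) i≤q) (cong (λ k → just (ones00 q k i)) (m∸n≡suc[m∸1+n] i<m))

      term-last : m ≤ q → bjmn q 2 m (suc m) ≡ just m
      term-last m≤q rewrite term m ≤-refl m≤q | n∸n≡0 m = refl

      stops-after : ∀ {i k} → bjmn q 2 m (suc i) ≡ nothing → i ≤ k → bjmn q 2 m (suc k) ≡ nothing
      stops-after = bIter-stopped q (onesZeros q m 2)

      stop-early : m < q ∸ 1 → bjmn q 2 m (suc (suc m)) ≡ nothing
      stop-early m<q-1 rewrite term-last (≤-trans (<⇒≤ m<q-1) (m∸n≤m q 1)) = step-below m m<q-1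

      reach-zero : m ≡ q ∸ 1 → bjmn q 2 m (suc (suc m)) ≡ just 0
      reach-zero refl rewrite term-last (m∸n≤m q 1) = step-q-1

      stop-after-zero : m ≡ q ∸ 1 → bjmn q 2 m (suc (suc (suc m))) ≡ nothing
      stop-after-zero m≡q-1 rewrite reach-zero m≡q-1 = step-below 0 (∸-monoˡ-≤ 1 2≤q)

      stop-late : q ≤ m → bjmn q 2 m (suc (suc q)) ≡ nothing
      stop-late q≤m rewrite term q q≤m ≤-refl = step-at-q (m ∸ q)

    module Window (sbar : ℕ) (1≤sbar : 1 ≤ sbar) (sbar<q : sbar < q) where

      window? : ℕ → ℕ → Bool
      window? b k = (wordVal q (rep sbar k) ≤ᵇ b) ∧ (b ≤ᵇ ones0 q k)

      bottom≤ones00 : ∀ j t → wordVal q (rep sbar (suc (suc j))) ≤ ones00 q (suc j) t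
      bottom≤ones00 j t = begin
        wordVal q (rep sbar (suc (suc j)))  ≡⟨ repdigit-value q sbar (suc (suc j)) ⟩
        sbar * repunit q (suc (suc j))      ≡⟨ cong (sbar *_) (repunit-suc (suc j)) ⟩
        sbar * (X * q + 1)                  ≡⟨ expand sbar (X * q) ⟩
        sbar * (X * q) + sbar               ≤⟨ +-monoʳ-≤ (sbar * (X * q)) sbar≤Xq ⟩
        sbar * (X * q) + X * q              ≡⟨ +-comm (sbar * (X * q)) (X * q) ⟩
        suc sbar * (X * q)                  ≤⟨ *-monoˡ-≤ (X * q) sbar<q ⟩
        q * (X * q)                         ≡⟨ *-comm q (X * q) ⟩
        X * q * q                           ≤⟨ m≤m+n _ t ⟩
        ones00 q (suc j) t                  ∎
        where
        X : ℕ
        X = repunit q (suc j)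
        expand : ∀ a y → a * (y + 1) ≡ a * y + a
        expand = solve-∀
        sbar≤Xq : sbar ≤ X * q
        sbar≤Xq = ≤-trans (<⇒≤ sbar<q) (≤-trans (≤-reflexive (sym (*-identityˡ q))) (*-monoˡ-≤ q (1≤repunit j)))

      lower-top<ones00 : ∀ j t k → k < suc (suc j) → ones0 q k < ones00 q (suc j) t
      lower-top<ones00 j t k k<j+2 = begin-strict
        ones0 q k                  ≡⟨ ones0-value q k ⟩
        repunit q k * q            ≤⟨ *-monoˡ-≤ q (repunit-mono (s≤s⁻¹ k<j+2)) ⟩
        repunit q (suc j) * q      <⟨ n<n*q (*-mono-≤ (1≤repunit j) 1≤q) ⟩
        repunit q (suc j) * q * q  ≤⟨ m≤m+n _ t ⟩
        ones00 q (suc j) t         ∎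

      k-ones00 : ∀ j t → t ≤ q → kOf q sbar (ones00 q (suc j) t) ≡ just (suc (suc j))
      k-ones00 j t t≤q = firstUpTo-just (window? b) b (suc (suc j))
        (≤-trans (k≤repunit (suc (suc j))) (repunit≤ones00 j t)) inside below
        where
        b : ℕ
        b = ones00 q (suc j) t
        top : b ≤ ones0 q (suc (suc j))
        top = ≤-trans (+-monoʳ-≤ (repunit q (suc j) * q * q) t≤q) (≤-reflexive (sym (ones0-suc (suc j))))
        inside : window? b (suc (suc j)) ≡ true
        inside rewrite ≤ᵇ-true (bottom≤ones00 j t) | ≤ᵇ-true top = refl
        below : ∀ k → k < suc (suc j) → window? b k ≡ false
        below k k<j+2 rewrite ≤ᵇ-false {b} {ones0 q k} (lower-top<ones00 j t k k<j+2) = ∧-zeroʳ _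

      k-small : ∀ t → 1 ≤ t → sbar ≤ t → t ≤ q → kOf q sbar t ≡ just 1
      k-small t 1≤t sbar≤t t≤q = firstUpTo-just (window? t) t 1 1≤t inside below
        where
        inside : window? t 1 ≡ true
        inside rewrite ≤ᵇ-true sbar≤t
                     | ≤ᵇ-true {t} {ones0 q 1} (≤-trans t≤q (≤-reflexive (sym (trans (ones0-value q 1) (+-identityʳ q))))) = refl
        below : ∀ k → k < 1 → window? t k ≡ false
        below zero _ rewrite ≤ᵇ-false {t} {0} 1≤t = refl
        below (suc k) (s≤s ())

      k-none : ∀ t → 1 ≤ t → t < sbar → kOf q sbar t ≡ nothing
      k-none t 1≤t t<sbar = firstUpTo-nothing (window? t) t outside
        where
        t<repdigit : ∀ k → t < wordVal q (rep sbar (suc k))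
        t<repdigit k = <-≤-trans t<sbar (≤-trans (m≤n+m sbar _) (≤-reflexive (sym (rep-value-suc q sbar k))))
        outside : ∀ k → k ≤ t → window? t k ≡ false
        outside zero _ rewrite ≤ᵇ-false {t} {0} 1≤t = ∧-zeroʳ (0 ≤ᵇ t)
        outside (suc k) _ rewrite ≤ᵇ-false {wordVal q (rep sbar (suc k))} {t} (t<repdigit k) = refl

module Binomials where

  open import Data.Empty using (⊥-elim)
  open import Data.Nat as ℕ using (zero; suc; s≤s; z<s)
  import Data.Nat.Properties as ℕ
  open import Data.Nat.Combinatorics using (k>n⇒nCk≡0; nCn≡1; nC1≡n; nCk≡nC[n∸k]; nCk+nC[k+1]≡[n+1]C[k+1])
  open import Data.Nat.Divisibility using (_∣_; divides; ∣⇒≤)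
  open import Data.Nat.DivMod using (_%_; _/_; m≡m%n+[m/n]*n; m%n<n)
  open import Data.Nat.Primality using (euclidsLemma)
  open import Data.Nat.Tactic.RingSolver using (solve-∀)
  open import Data.Sum using (inj₁; inj₂)
  import Relation.Binary.PropositionalEquality as ≡
  open ≡ using (_≡_)

  C-absorb : ∀ n k → suc k * (suc n C suc k) ≡ suc n * (n C k)
  C-absorb zero zero = ≡.refl
  C-absorb zero (suc k) rewrite k>n⇒nCk≡0 {1} {suc (suc k)} (s≤s z<s) | k>n⇒nCk≡0 {0} {suc k} z<s =
    ℕ.*-zeroʳ (suc (suc k))
  C-absorb (suc n) zero = begin
    1 * (suc (suc n) C 1)  ≡⟨ ℕ.*-identityˡ _ ⟩
    suc (suc n) C 1        ≡⟨ nC1≡n _ ⟩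
    suc (suc n)            ≡⟨ ℕ.*-identityʳ _ ⟨
    suc (suc n) * 1        ∎
    where open ≡.≡-Reasoning
  C-absorb (suc n) (suc k) = begin
    suc (suc k) * (suc (suc n) C suc (suc k))  ≡⟨ ≡.cong (suc (suc k) *_) (nCk+nC[k+1]≡[n+1]C[k+1] (suc n) (suc k)) ⟨
    suc (suc k) * (U + V)                      ≡⟨ expand k U V ⟩
    suc k * U + U + suc (suc k) * V            ≡⟨ ≡.cong₂ (λ a b → a + U + b) (C-absorb n k) (C-absorb n (suc k)) ⟩
    suc n * X + U + suc n * Y                  ≡⟨ ≡.cong (λ u → suc n * X + u + suc n * Y) (nCk+nC[k+1]≡[n+1]C[k+1] n k) ⟨
    suc n * X + (X + Y) + suc n * Y            ≡⟨ collect n X Y ⟩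
    suc (suc n) * (X + Y)                      ≡⟨ ≡.cong (suc (suc n) *_) (nCk+nC[k+1]≡[n+1]C[k+1] n k) ⟩
    suc (suc n) * U                            ∎
    where
    open ≡.≡-Reasoning
    X : ℕ
    X = n C k
    Y : ℕ
    Y = n C suc k
    U : ℕ
    U = suc n C suc k
    V : ℕ
    V = suc n C suc (suc k)
    expand : ∀ k U V → suc (suc k) * (U + V) ≡ suc k * U + U + suc (suc k) * V
    expand = solve-∀
    collect : ∀ n X Y → suc n * X + (X + Y) + suc n * Y ≡ suc (suc n) * (X + Y)
    collect = solve-∀

  prime∣C : ∀ {p} → Prime p → ∀ i → 0 < i → i < p → p ∣ p C i
  prime∣C {suc n} pp (suc k) _ i<p
    with euclidsLemma (suc k) (suc n C suc k) pp (divides (n C k) (≡.trans (C-absorb n k) (ℕ.*-comm (suc n) _)))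
  ... | inj₁ p∣i = ⊥-elim (ℕ.<⇒≱ i<p (∣⇒≤ p∣i))
  ... | inj₂ p∣C = p∣C

  C-suc-self : ∀ n → suc n C n ≡ suc n
  C-suc-self n = ≡.trans (nCk≡nC[n∸k] (ℕ.n≤1+n n)) (≡.trans (≡.cong (suc n C_) (ℕ.m+n∸n≡m 1 n)) (nC1≡n (suc n)))

  module InRing {c ℓ : Level} (F : CommutativeRing c ℓ) where
    open CommutativeRing F renaming (_+_ to _⊕_; _*_ to _·_) hiding (zero)
    open import Relation.Binary.Reasoning.Setoid setoid
    open import Algebra.Properties.Semiring.Mult semiring using (×-homo-+; ×1-homo-*)
    open import Algebra.Properties.CommutativeSemigroup +-commutativeSemigroup using (interchange)

    natF-+ : ∀ m n → natF F (m + n) ≈ natF F m ⊕ natF F n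
    natF-+ m n = ×-homo-+ 1# m n

    natF-* : ∀ m n → natF F (m * n) ≈ natF F m · natF F n
    natF-* = ×1-homo-*

    natF-1 : natF F 1 ≈ 1#
    natF-1 = +-identityʳ 1#

    binom : ℕ → ℕ → Carrier
    binom n k = natF F (n C k)

    binom-≡ : ∀ {n k n′ k′} → n ≡ n′ → k ≡ k′ → binom n k ≈ binom n′ k′
    binom-≡ ≡.refl ≡.refl = refl

    pascal : ∀ n k → binom (suc n) (suc k) ≈ binom n k ⊕ binom n (suc k)
    pascal n k = trans (reflexive (≡.cong (natF F) (≡.sym (nCk+nC[k+1]≡[n+1]C[k+1] n k)))) (natF-+ (n C k) (n C suc k))

    binom-above : ∀ {n k} → n < k → binom n k ≈ 0#
    binom-above n<k = reflexive (≡.cong (natF F) (k>n⇒nCk≡0 n<k))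

    binom-diag : ∀ n → binom n n ≈ 1#
    binom-diag n = trans (reflexive (≡.cong (natF F) (nCn≡1 n))) natF-1

    -- q is "Frobenius-like" in F: the binomial expansion of (1 + X)^q has
    -- no middle terms.
    MiddleVanish : ℕ → Set ℓ
    MiddleVanish q = ∀ i → 0 < i → i < q → binom q i ≈ 0#

    module Lucas (q′ : ℕ) (vanish : MiddleVanish (suc q′)) where
      q : ℕ
      q = suc q′

      shift-small : ∀ n k → k < q → binom (n + q) k ≈ binom n k
      shift-small zero    zero    _   = refl
      shift-small zero    (suc k) k<q = vanish (suc k) z<s k<q
      shift-small (suc n) zero    _   = refl
      shift-small (suc n) (suc k) k<q = begin
        binom (suc n + q) (suc k)                ≈⟨ pascal (n + q) k ⟩
        binom (n + q) k ⊕ binom (n + q) (suc k)  ≈⟨ +-cong (shift-small n k (ℕ.<-trans (ℕ.n<1+n k) k<q)) (shift-small n (suc k) k<q) ⟩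
        binom n k ⊕ binom n (suc k)              ≈⟨ pascal n k ⟨
        binom (suc n) (suc k)                    ∎

      shift-big : ∀ n k → binom (n + q) (q + k) ≈ binom n (q + k) ⊕ binom n k
      shift-big zero zero = begin
        binom q (q + 0)  ≈⟨ binom-≡ {n = q} ≡.refl (ℕ.+-identityʳ q) ⟩
        binom q q        ≈⟨ binom-diag q ⟩
        1#               ≈⟨ natF-1 ⟨
        natF F 1         ≈⟨ +-identityˡ _ ⟨
        0# ⊕ natF F 1    ∎
      shift-big zero (suc k) = begin
        binom q (q + suc k)  ≈⟨ binom-above (ℕ.m<m+n q z<s) ⟩
        0#                   ≈⟨ +-identityˡ 0# ⟨
        0# ⊕ 0#              ∎
      shift-big (suc n) zero = begin
        binom (suc n + q) (q + 0)
          ≈⟨ pascal (n + q) (q′ + 0) ⟩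
        binom (n + q) (q′ + 0) ⊕ binom (n + q) (q + 0)
          ≈⟨ +-cong (shift-small n (q′ + 0) (s≤s (ℕ.≤-reflexive (ℕ.+-identityʳ q′)))) (shift-big n 0) ⟩
        binom n (q′ + 0) ⊕ (binom n (q + 0) ⊕ natF F 1)
          ≈⟨ +-assoc (binom n (q′ + 0)) (binom n (q + 0)) (natF F 1) ⟨
        (binom n (q′ + 0) ⊕ binom n (q + 0)) ⊕ natF F 1
          ≈⟨ +-congʳ (pascal n (q′ + 0)) ⟨
        binom (suc n) (q + 0) ⊕ natF F 1
          ∎
      shift-big (suc n) (suc k) = begin
        binom (suc n + q) (q + suc k)
          ≈⟨ pascal (n + q) (q′ + suc k) ⟩
        binom (n + q) (q′ + suc k) ⊕ binom (n + q) (q + suc k)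
          ≈⟨ +-congʳ (binom-≡ {n = n + q} ≡.refl (ℕ.+-suc q′ k)) ⟩
        binom (n + q) (q + k) ⊕ binom (n + q) (q + suc k)
          ≈⟨ +-cong (shift-big n k) (shift-big n (suc k)) ⟩
        (binom n (q + k) ⊕ binom n k) ⊕ (binom n (q + suc k) ⊕ binom n (suc k))
          ≈⟨ interchange _ _ _ _ ⟩
        (binom n (q + k) ⊕ binom n (q + suc k)) ⊕ (binom n k ⊕ binom n (suc k))
          ≈⟨ +-congʳ (+-congʳ (binom-≡ {n = n} ≡.refl (ℕ.+-suc q′ k))) ⟨
        (binom n (q′ + suc k) ⊕ binom n (q + suc k)) ⊕ (binom n k ⊕ binom n (suc k))
          ≈⟨ +-cong (pascal n (q′ + suc k)) (pascal n k) ⟨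
        binom (suc n) (q + suc k) ⊕ binom (suc n) (suc k)
          ∎

      digit-shift : ∀ A a → suc A * q + a ≡ A * q + a + q
      digit-shift A a = ≡.trans (ℕ.+-assoc q (A * q) a) (ℕ.+-comm q _)

      lucas : ∀ A a B b → a < q → b < q → binom (A * q + a) (B * q + b) ≈ binom A B · binom a b
      lucas zero a zero b _ _ = begin
        binom a b             ≈⟨ *-identityˡ _ ⟨
        1# · binom a b        ≈⟨ *-congʳ natF-1 ⟨
        natF F 1 · binom a b  ∎
      lucas zero a (suc B) b a<q _ = begin
        binom a (suc B * q + b)  ≈⟨ binom-above (ℕ.<-≤-trans a<q (ℕ.≤-trans (ℕ.m≤m+n q _) (ℕ.m≤m+n _ b))) ⟩
        0#                       ≈⟨ zeroˡ _ ⟨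
        0# · binom a b           ∎
      lucas (suc A) a zero b a<q b<q = begin
        binom (suc A * q + a) b  ≈⟨ binom-≡ {k = b} (digit-shift A a) ≡.refl ⟩
        binom (A * q + a + q) b  ≈⟨ shift-small (A * q + a) b b<q ⟩
        binom (A * q + a) b      ≈⟨ lucas A a zero b a<q b<q ⟩
        natF F 1 · binom a b     ∎
      lucas (suc A) a (suc B) b a<q b<q = begin
        binom (suc A * q + a) (suc B * q + b)
          ≈⟨ binom-≡ (digit-shift A a) (ℕ.+-assoc q (B * q) b) ⟩
        binom (A * q + a + q) (q + (B * q + b))
          ≈⟨ shift-big (A * q + a) (B * q + b) ⟩
        binom (A * q + a) (q + (B * q + b)) ⊕ binom (A * q + a) (B * q + b)
          ≈⟨ +-congʳ (binom-≡ {n = A * q + a} ≡.refl (ℕ.+-assoc q (B * q) b)) ⟨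
        binom (A * q + a) (suc B * q + b) ⊕ binom (A * q + a) (B * q + b)
          ≈⟨ +-cong (lucas A a (suc B) b a<q b<q) (lucas A a B b a<q b<q) ⟩
        binom A (suc B) · binom a b ⊕ binom A B · binom a b
          ≈⟨ distribʳ (binom a b) (binom A (suc B)) (binom A B) ⟨
        (binom A (suc B) ⊕ binom A B) · binom a b
          ≈⟨ *-congʳ (trans (pascal A B) (+-comm (binom A B) (binom A (suc B)))) ⟨
        binom (suc A) (suc B) · binom a b
          ∎

    -- The same for arbitrary q (q = 0 is excluded by a < q).
    lucas : ∀ {q} → MiddleVanish q → ∀ A a B b → a < q → b < q →
            binom (A * q + a) (B * q + b) ≈ binom A B · binom a b
    lucas {suc q′} vanish = Lucas.lucas q′ vanish

    module PrimeCharacteristic (p : ℕ) (p-prime : Prime p) (p≈0 : natF F p ≈ 0#) where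

      natF-multiple : ∀ {x} → p ∣ x → natF F x ≈ 0#
      natF-multiple (divides k ≡.refl) = begin
        natF F (k * p)       ≈⟨ natF-* k p ⟩
        natF F k · natF F p  ≈⟨ *-congˡ p≈0 ⟩
        natF F k · 0#        ≈⟨ zeroʳ _ ⟩
        0#                   ∎

      vanish-p : MiddleVanish p
      vanish-p i 0<i i<p = natF-multiple (prime∣C p-prime i 0<i i<p)

      -- From MiddleVanish q to MiddleVanish (p·q): by Lucas in base q,
      -- C(pq, i) = C(p, i / q)·C(0, i mod q), and one of the factors vanishes.
      vanish-* : ∀ {q} → MiddleVanish q → MiddleVanish (p * q)
      vanish-* {zero} _ i 0<i i<0 = ⊥-elim (ℕ.n≮0 (≡.subst (i <_) (ℕ.*-zeroʳ p) i<0))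
      vanish-* {q@(suc _)} vanish i 0<i i<pq = begin
        binom (p * q) i                          ≈⟨ binom-≡ (≡.sym (ℕ.+-identityʳ (p * q))) i≡ ⟩
        binom (p * q + 0) ((i / q) * q + i % q)  ≈⟨ lucas vanish p 0 (i / q) (i % q) z<s (m%n<n i q) ⟩
        binom p (i / q) · binom 0 (i % q)        ≈⟨ one-vanishes (i % q) ≡.refl ⟩
        0#                                       ∎
        where
        i≡ : i ≡ (i / q) * q + i % q
        i≡ = ≡.trans (m≡m%n+[m/n]*n i q) (ℕ.+-comm (i % q) _)
        one-vanishes : ∀ r → i % q ≡ r → binom p (i / q) · binom 0 r ≈ 0#
        one-vanishes (suc r) _ = zeroʳ _
        one-vanishes zero i%q≡0 = begin
          binom p (i / q) · natF F 1  ≈⟨ *-congʳ (vanish-p (i / q) 0<i/q i/q<p) ⟩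
          0# · natF F 1               ≈⟨ zeroˡ _ ⟩
          0#                          ∎
          where
          i≡[i/q]q : i ≡ (i / q) * q
          i≡[i/q]q = ≡.trans (m≡m%n+[m/n]*n i q) (≡.cong (_+ (i / q) * q) i%q≡0)
          0<i/q : 0 < i / q
          0<i/q = ℕ.n≢0⇒n>0 λ i/q≡0 → ℕ.<⇒≢ 0<i (≡.sym (≡.trans i≡[i/q]q (≡.cong (_* q) i/q≡0)))
          i/q<p : i / q < p
          i/q<p = ℕ.*-cancelʳ-< q (i / q) p (≡.subst (_< p * q) i≡[i/q]q i<pq)

      vanish-pow : ∀ e → MiddleVanish (p ^ e)
      vanish-pow zero i 0<i i<1 = ⊥-elim (ℕ.<⇒≱ 0<i (ℕ.≤-pred i<1))
      vanish-pow (suc e) = vanish-* (vanish-pow e)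

module FiniteField where

  open import Level using (_⊔_)
  open import Data.Empty using (⊥-elim)
  open import Data.Fin as Fin using (Fin; zero; suc)
  import Data.Fin.Properties as Fin
  open import Data.Fin.Permutation using (permutation)
  open import Data.Nat using (zero; suc; z≤n; s≤s)
  import Data.Nat.Properties as ℕ
  open import Data.Nat.Tactic.RingSolver using (solve-∀)
  open Decomposition using (repunit; rep-value-suc)
  open import Data.Product using (∃; proj₁; proj₂)
  open import Relation.Nullary using (¬_; Dec; yes; no)
  open import Relation.Nullary.Decidable using (map′)
  import Relation.Binary.PropositionalEquality as ≡

  module Fermat {c ℓ : Level} (F : CommutativeRing c ℓ) {q : ℕ} (finite : IsFiniteFieldOfOrder F q) where
    open CommutativeRing F renaming (_*_ to _·_) hiding (zero; _+_)
    open IsFiniteFieldOfOrder finite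
    open import Relation.Binary.Reasoning.Setoid setoid
    open import Algebra.Properties.Semiring.Exp semiring using (^-homo-*; ^-assocʳ; ^-congˡ)
    open import Algebra.Properties.CommutativeMonoid.Sum *-commutativeMonoid
      using (sum-permute; ∑-distrib-+; sum-replicate) renaming (sum to product)
    open import Algebra.Properties.CommutativeSemigroup *-commutativeSemigroup using (interchange; x∙yz≈y∙xz)

    product-cong : ∀ {n} {f g : Fin n → Carrier} → (∀ i → f i ≈ g i) → product f ≈ product g
    product-cong {zero} _ = refl
    product-cong {suc n} f≈g = *-cong (f≈g zero) (product-cong (λ i → f≈g (suc i)))

    product-scale : ∀ {n} x (f : Fin n → Carrier) → product (λ i → x · f i) ≈ powF F x n · product f
    product-scale {n} x f = trans (∑-distrib-+ (λ _ → x) f) (*-congʳ (sum-replicate n))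

    product-one-factor : ∀ {n} x (f g : Fin n → Carrier) (j : Fin n) →
                         (∀ i → ¬ i ≡.≡ j → f i ≈ g i) → f j ≈ x · g j → product f ≈ x · product g
    product-one-factor x f g zero agree fj = begin
      f zero · product (λ i → f (suc i))        ≈⟨ *-cong fj (product-cong (λ i → agree (suc i) λ ())) ⟩
      (x · g zero) · product (λ i → g (suc i))  ≈⟨ *-assoc _ _ _ ⟩
      x · (g zero · product (λ i → g (suc i)))  ∎
    product-one-factor x f g (suc j) agree fj = begin
      f zero · product (λ i → f (suc i))
        ≈⟨ *-cong (agree zero λ ()) (product-one-factor x (λ i → f (suc i)) (λ i → g (suc i)) j
                                      (λ i i≢j → agree (suc i) (λ e → i≢j (Fin.suc-injective e))) fj) ⟩
      g zero · (x · product (λ i → g (suc i)))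
        ≈⟨ x∙yz≈y∙xz _ _ _ ⟩
      x · (g zero · product (λ i → g (suc i)))
        ∎

    Invertible : Carrier → Set (c ⊔ ℓ)
    Invertible y = ∃ λ z → y · z ≈ 1#

    product-invertible : ∀ {n} (f : Fin n → Carrier) → (∀ i → Invertible (f i)) → Invertible (product f)
    product-invertible {zero} f _ = 1# , *-identityˡ 1#
    product-invertible {suc n} f inv with inv zero | product-invertible (λ i → f (suc i)) (λ i → inv (suc i))
    ... | z₀ , e₀ | z , e = z₀ · z , (begin
      (f zero · product (λ i → f (suc i))) · (z₀ · z)  ≈⟨ interchange _ _ _ _ ⟩
      (f zero · z₀) · (product (λ i → f (suc i)) · z)  ≈⟨ *-cong e₀ e ⟩
      1# · 1#                                          ≈⟨ *-identityˡ 1# ⟩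
      1#                                               ∎)

    cancel : ∀ {a b y} → a · y ≈ b · y → Invertible y → a ≈ b
    cancel {a} {b} {y} ay≈by (z , yz≈1) = begin
      a            ≈⟨ *-identityʳ a ⟨
      a · 1#       ≈⟨ *-congˡ yz≈1 ⟨
      a · (y · z)  ≈⟨ *-assoc _ _ _ ⟨
      (a · y) · z  ≈⟨ *-congʳ ay≈by ⟩
      (b · y) · z  ≈⟨ *-assoc _ _ _ ⟩
      b · (y · z)  ≈⟨ *-congˡ yz≈1 ⟩
      b · 1#       ≈⟨ *-identityʳ b ⟩
      b            ∎

    index : Carrier → Fin q
    index y = proj₁ (enum-surjective y)

    enum-index : ∀ y → enum (index y) ≈ y
    enum-index y = proj₂ (enum-surjective y)

    index-cong : ∀ {x y} → x ≈ y → index x ≡.≡ index y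
    index-cong {x} {y} x≈y = enum-injective _ _ (trans (enum-index x) (trans x≈y (sym (enum-index y))))

    _≈0? : ∀ y → Dec (y ≈ 0#)
    y ≈0? = map′ from index-cong (index y Fin.≟ index 0#)
      where
      from : index y ≡.≡ index 0# → y ≈ 0#
      from e = trans (sym (enum-index y)) (trans (reflexive (≡.cong enum e)) (enum-index 0#))

    -- Replace 0 by 1: a function with invertible values.
    nonzero : Carrier → Carrier
    nonzero y with y ≈0?
    ... | yes _ = 1#
    ... | no _ = y

    nonzero-0 : ∀ {y} → y ≈ 0# → nonzero y ≈ 1#
    nonzero-0 {y} y≈0 with y ≈0?
    ... | yes _ = refl
    ... | no y≉0 = ⊥-elim (y≉0 y≈0)

    nonzero-≉0 : ∀ {y} → ¬ y ≈ 0# → nonzero y ≈ y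
    nonzero-≉0 {y} y≉0 with y ≈0?
    ... | yes y≈0 = ⊥-elim (y≉0 y≈0)
    ... | no _ = refl

    nonzero-cong : ∀ {a b} → a ≈ b → nonzero a ≈ nonzero b
    nonzero-cong {a} {b} a≈b with a ≈0? | b ≈0?
    ... | yes _   | yes _   = refl
    ... | no _    | no _    = a≈b
    ... | yes a≈0 | no b≉0  = ⊥-elim (b≉0 (trans (sym a≈b) a≈0))
    ... | no a≉0  | yes b≈0 = ⊥-elim (a≉0 (trans a≈b b≈0))

    nonzero-invertible : ∀ y → Invertible (nonzero y)
    nonzero-invertible y with y ≈0?
    ... | yes _ = 1# , *-identityˡ 1#
    ... | no y≉0 = inverse y y≉0

    -- Fermat's little theorem for F: multiplication by x ≉ 0 permutes F,
    -- so ∏ (x·y) over the nonzero y equals ∏ y, i.e. x^q·P = x·P with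
    -- P = ∏ nonzero(y) invertible.
    module _ (x : Carrier) (x≉0 : ¬ x ≈ 0#) where
      x⁻¹ : Carrier
      x⁻¹ = proj₁ (inverse x x≉0)

      x*x⁻¹ : x · x⁻¹ ≈ 1#
      x*x⁻¹ = proj₂ (inverse x x≉0)

      cancels : ∀ a b y → a · b ≈ 1# → a · (b · y) ≈ y
      cancels a b y ab≈1 = trans (sym (*-assoc _ _ _)) (trans (*-congʳ ab≈1) (*-identityˡ y))

      scale unscale : Fin q → Fin q
      scale i = index (x · enum i)
      unscale i = index (x⁻¹ · enum i)

      scale-unscale : ∀ i → scale (unscale i) ≡.≡ i
      scale-unscale i = enum-injective _ _
        (trans (enum-index _) (trans (*-congˡ (enum-index _)) (cancels x x⁻¹ _ x*x⁻¹)))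

      unscale-scale : ∀ i → unscale (scale i) ≡.≡ i
      unscale-scale i = enum-injective _ _
        (trans (enum-index _) (trans (*-congˡ (enum-index _)) (cancels x⁻¹ x _ (trans (*-comm _ _) x*x⁻¹))))

      *-≉0 : ∀ {y} → ¬ y ≈ 0# → ¬ (x · y) ≈ 0#
      *-≉0 {y} y≉0 xy≈0 = y≉0 (begin
        y              ≈⟨ cancels x⁻¹ x y (trans (*-comm _ _) x*x⁻¹) ⟨
        x⁻¹ · (x · y)  ≈⟨ *-congˡ xy≈0 ⟩
        x⁻¹ · 0#       ≈⟨ zeroʳ _ ⟩
        0#             ∎)

      P : Carrier
      P = product (λ i → nonzero (enum i))

      P-scaled : P ≈ product (λ i → nonzero (x · enum i))
      P-scaled = trans (sum-permute (λ i → nonzero (enum i)) (permutation scale unscale scale-unscale unscale-scale))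
                       (product-cong (λ i → nonzero-cong (enum-index (x · enum i))))

      fermat : powF F x q ≈ x
      fermat = cancel (begin
        powF F x q · P                            ≈⟨ product-scale x (λ i → nonzero (enum i)) ⟨
        product (λ i → x · nonzero (enum i))      ≈⟨ product-one-factor x _ _ (index 0#) agree at-zero ⟩
        x · product (λ i → nonzero (x · enum i))  ≈⟨ *-congˡ P-scaled ⟨
        x · P                                     ∎) (product-invertible _ (λ i → nonzero-invertible (enum i)))
        where
        enum-≉0 : ∀ i → ¬ i ≡.≡ index 0# → ¬ enum i ≈ 0#
        enum-≉0 i i≢ e = i≢ (enum-injective i (index 0#) (trans e (sym (enum-index 0#))))
        agree : ∀ i → ¬ i ≡.≡ index 0# → x · nonzero (enum i) ≈ nonzero (x · enum i)
        agree i i≢ = trans (*-congˡ (nonzero-≉0 (enum-≉0 i i≢))) (sym (nonzero-≉0 (*-≉0 (enum-≉0 i i≢))))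
        at-zero : x · nonzero (enum (index 0#)) ≈ x · nonzero (x · enum (index 0#))
        at-zero = *-congˡ (trans (nonzero-0 (enum-index 0#))
                                 (sym (nonzero-0 (trans (*-congˡ (enum-index 0#)) (zeroʳ x)))))

    1≤q : 1 ≤ q
    1≤q = ℕ.≤-trans (s≤s z≤n) (Fin.toℕ<n (index 0#))

    frobenius : ∀ x → powF F x q ≈ x
    frobenius x with x ≈0?
    ... | no x≉0 = fermat x x≉0
    ... | yes x≈0 = zero-power q 1≤q
      where
      zero-power : ∀ n → 1 ≤ n → powF F x n ≈ x
      zero-power (suc n) _ = trans (*-congʳ x≈0) (trans (zeroˡ _) (sym x≈0))

    -- Consequently an exponent may be replaced by the sum of its base-q
    -- digits; in particular the repunit [1^j]_q counts as j.
    pow-digits : ∀ y w u → powF F y (w * q + u) ≈ powF F y (w + u)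
    pow-digits y w u = begin
      powF F y (w * q + u)                ≈⟨ ^-homo-* y (w * q) u ⟩
      powF F y (w * q) · powF F y u       ≈⟨ *-congʳ (reflexive (≡.cong (powF F y) (ℕ.*-comm w q))) ⟩
      powF F y (q * w) · powF F y u       ≈⟨ *-congʳ (^-assocʳ y q w) ⟨
      powF F (powF F y q) w · powF F y u  ≈⟨ *-congʳ (^-congˡ w (frobenius y)) ⟩
      powF F y w · powF F y u             ≈⟨ ^-homo-* y w u ⟨
      powF F y (w + u)                    ∎

    pow-repunit : ∀ y x j u → powF F y (x * repunit q j + u) ≈ powF F y (x * j + u)
    pow-repunit y x zero u = reflexive (≡.cong (λ z → powF F y (z + u)) (≡.trans (ℕ.*-zeroʳ x) (≡.sym (ℕ.*-zeroʳ x))))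
    pow-repunit y x (suc j) u = begin
      powF F y (x * repunit q (suc j) + u)     ≡⟨ ≡.cong (powF F y) (≡.trans (≡.cong (λ r → x * r + u) (rep-value-suc q 1 j))
                                                                              (regroup x (repunit q j) q u)) ⟩
      powF F y (x * repunit q j * q + (x + u))  ≈⟨ pow-digits y (x * repunit q j) (x + u) ⟩
      powF F y (x * repunit q j + (x + u))      ≈⟨ pow-repunit y x j (x + u) ⟩
      powF F y (x * j + (x + u))                ≡⟨ ≡.cong (powF F y) (collect x j u) ⟩
      powF F y (x * suc j + u)                  ∎
      where
      regroup : ∀ x r q u → x * (r * q + 1) + u ≡.≡ x * r * q + (x + u)
      regroup = solve-∀
      collect : ∀ x j u → x * j + (x + u) ≡.≡ x * suc j + u
      collect = solve-∀

module Evaluation where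

  open Decomposition
  open Binomials
  open FiniteField
  open import Data.Maybe using (just; nothing)
  open import Data.Empty using (⊥-elim)
  open import Data.Sum using (inj₁; inj₂)
  open import Data.Nat as ℕ using (zero; suc; z≤n; s≤s; z<s)
  open import Relation.Binary.Definitions using (tri<; tri≈; tri>)
  import Data.Nat.Properties as ℕ
  open import Data.Nat.Divisibility using (_∣_; divides)
  open import Data.Nat.Tactic.RingSolver using (solve-∀)
  import Relation.Binary.PropositionalEquality as ≡
  open ≡ using (_≡_)

  -- Here X stands for [1^j]_q, so [1^(j+1)]_q = Xq + 1; after substituting
  -- q = sbar + s (and s = 1 + (s - 1)) these are polynomial identities.

  split-low : ∀ q sbar s s-1 X t → s ≡ suc s-1 → q ≡ sbar + s →
    (X * q + 1) * q * q + t ≡ sbar * ((X * q + 1) * q + 1) + ((s * X * q + s-1) * q + (s + t))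
  split-low .(sbar + suc s-1) sbar .(suc s-1) s-1 X t ≡.refl ≡.refl = identity X sbar s-1 t
    where
    identity : ∀ X sbar s-1 t →
      (X * (sbar + suc s-1) + 1) * (sbar + suc s-1) * (sbar + suc s-1) + t
        ≡ sbar * ((X * (sbar + suc s-1) + 1) * (sbar + suc s-1) + 1)
          + ((suc s-1 * X * (sbar + suc s-1) + s-1) * (sbar + suc s-1) + (suc s-1 + t))
    identity = solve-∀

  split-high : ∀ q sbar s X u → q ≡ sbar + s →
    (X * q + 1) * q * q + (sbar + u) ≡ sbar * ((X * q + 1) * q + 1) + (s * (X * q + 1) * q + u)
  split-high .(sbar + s) sbar s X u ≡.refl = identity X sbar s u
    where
    identity : ∀ X sbar s u →
      (X * (sbar + s) + 1) * (sbar + s) * (sbar + s) + (sbar + u)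
        ≡ sbar * ((X * (sbar + s) + 1) * (sbar + s) + 1) + (s * (X * (sbar + s) + 1) * (sbar + s) + u)
    identity = solve-∀

  top-digits-low : ∀ q s s-1 X → s ≡ suc s-1 → s * ((X * q + 1) * q + 1) ≡ suc (s * X * q + s-1) * q + s
  top-digits-low q .(suc s-1) s-1 X ≡.refl = identity q X s-1
    where
    identity : ∀ q X s-1 → suc s-1 * ((X * q + 1) * q + 1) ≡ suc (suc s-1 * X * q + s-1) * q + suc s-1
    identity = solve-∀

  top-digits-high : ∀ q s X → s * ((X * q + 1) * q + 1) ≡ s * (X * q + 1) * q + s
  top-digits-high = solve-∀

  module Values {c ℓ : Level} (F : CommutativeRing c ℓ) (p e : ℕ) (p-prime : Prime p) (1≤e : 1 ≤ e)
    (finite : IsFiniteFieldOfOrder F (p ^ e)) (p≈0 : CommutativeRing._≈_ F (natF F p) (CommutativeRing.0# F))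
    (a : CommutativeRing.Carrier F) (s : ℕ) (1<s : 1 < s) (s<q : s < p ^ e) where

    open CommutativeRing F renaming (_+_ to _⊕_; _*_ to _·_) hiding (zero)
    open import Relation.Binary.Reasoning.Setoid setoid
    open import Algebra.Properties.Semiring.Exp semiring using (^-homo-*; ^-assocʳ; ^-congˡ)
    open import Algebra.Properties.Ring ring using (-1*x≈-x; -‿involutive)
    open InRing F
    open PrimeCharacteristic p p-prime p≈0
    open Fermat F finite using (pow-digits; pow-repunit)

    q : ℕ
    q = p ^ e
    sbar : ℕ
    sbar = q ∸ s
    s-1 : ℕ
    s-1 = s ∸ 1

    s≡1+[s-1] : s ≡ suc s-1
    s≡1+[s-1] = ≡.sym (ℕ.suc-pred s {{ℕ.>-nonZero (ℕ.<-trans z<s 1<s)}})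

    q≡sbar+s : q ≡ sbar + s
    q≡sbar+s = ≡.sym (ℕ.m∸n+n≡m (ℕ.<⇒≤ s<q))

    2≤q : 2 ≤ q
    2≤q = ℕ.≤-trans 1<s (ℕ.<⇒≤ s<q)

    1≤sbar : 1 ≤ sbar
    1≤sbar = ℕ.m<n⇒0<n∸m s<q

    sbar<q : sbar < q
    sbar<q = ℕ.∸-monoʳ-< {q} {s} {0} (ℕ.<-trans z<s 1<s) (ℕ.<⇒≤ s<q)

    open InBase q 2≤q
    open Window sbar 1≤sbar sbar<q

    pow : Carrier → ℕ → Carrier
    pow = powF F

    -1ᶠ : Carrier
    -1ᶠ = minusOne F

    -- q = 0 in F, so natF only sees the last base-q digit.
    natF-q : natF F q ≈ 0#
    natF-q = natF-multiple (p∣p^e e 1≤e)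
      where
      p∣p^e : ∀ e → 1 ≤ e → p ∣ p ^ e
      p∣p^e (suc e) _ = divides (p ^ e) (ℕ.*-comm p _)

    natF-last-digit : ∀ w r → natF F (w * q + r) ≈ natF F r
    natF-last-digit w r = begin
      natF F (w * q + r)              ≈⟨ natF-+ (w * q) r ⟩
      natF F (w * q) ⊕ natF F r       ≈⟨ +-congʳ (natF-* w q) ⟩
      natF F w · natF F q ⊕ natF F r  ≈⟨ +-congʳ (trans (*-congˡ natF-q) (zeroʳ _)) ⟩
      0# ⊕ natF F r                   ≈⟨ +-identityˡ _ ⟩
      natF F r                        ∎

    sign-even : ∀ x y → pow -1ᶠ (2 * x + y) ≈ pow -1ᶠ y
    sign-even x y = begin
      pow -1ᶠ (2 * x + y)            ≈⟨ ^-homo-* -1ᶠ (2 * x) y ⟩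
      pow -1ᶠ (2 * x) · pow -1ᶠ y    ≈⟨ *-congʳ (^-assocʳ -1ᶠ 2 x) ⟨
      pow (pow -1ᶠ 2) x · pow -1ᶠ y  ≈⟨ *-congʳ (trans (^-congˡ x square) (pow-1# x)) ⟩
      1# · pow -1ᶠ y                 ≈⟨ *-identityˡ _ ⟩
      pow -1ᶠ y                      ∎
      where
      square : pow -1ᶠ 2 ≈ 1#
      square = trans (*-congˡ (*-identityʳ -1ᶠ)) (trans (-1*x≈-x -1ᶠ) (-‿involutive 1#))
      pow-1# : ∀ n → pow 1# n ≈ 1#
      pow-1# zero = refl
      pow-1# (suc n) = trans (*-identityˡ _) (pow-1# n)

    sign-window : ∀ j → pow -1ᶠ (suc (suc j) * s-1) ≈ pow -1ᶠ (s-1 * j)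
    sign-window j = trans (reflexive (≡.cong (pow -1ᶠ) (expand j s-1))) (sign-even s-1 (s-1 * j))
      where
      expand : ∀ j s-1 → suc (suc j) * s-1 ≡ 2 * s-1 + s-1 * j
      expand = solve-∀

    d : ℕ → ℕ → Carrier
    d = dF F q s a 2

    d-stopped : ∀ {m n} → bjmn q 2 m n ≡ nothing → d m n ≈ 0#
    d-stopped stopped rewrite stopped = refl

    d-outside : ∀ {m n b} → bjmn q 2 m n ≡ just b → kOf q sbar b ≡ nothing → d m n ≈ 0#
    d-outside term outside rewrite term | outside = refl

    d-window : ∀ {m n b k} → bjmn q 2 m n ≡ just b → kOf q sbar b ≡ just k →
               d m n ≈ binom (wordVal q (rep s k)) (b ∸ wordVal q (rep sbar k))
                       · pow (- a) (b ∸ wordVal q (rep sbar k)) · pow -1ᶠ (k * s-1) · pow -1ᶠ (n ∸ 1)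
    d-window term window rewrite term | window = reorder _ _ _ _
      where
      reorder : ∀ x₁ x₂ x₃ x₄ → x₁ · (x₂ · (x₃ · x₄)) ≈ x₂ · x₃ · x₁ · x₄
      reorder x₁ x₂ x₃ x₄ = begin
        x₁ · (x₂ · (x₃ · x₄))  ≈⟨ *-congˡ (*-assoc x₂ x₃ x₄) ⟨
        x₁ · ((x₂ · x₃) · x₄)  ≈⟨ *-assoc x₁ (x₂ · x₃) x₄ ⟨
        (x₁ · (x₂ · x₃)) · x₄  ≈⟨ *-congʳ (*-comm x₁ (x₂ · x₃)) ⟩
        (x₂ · x₃) · x₁ · x₄    ∎

    bottom : ℕ → ℕ
    bottom j = wordVal q (rep sbar (suc (suc j)))

    top : ℕ → ℕ
    top j = wordVal q (rep s (suc (suc j)))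

    excess : ℕ → ℕ → ℕ
    excess j t = ones00 q (suc j) t ∸ bottom j

    ones00-expand : ∀ j t → ones00 q (suc j) t ≡ (repunit q j * q + 1) * q * q + t
    ones00-expand j t = ≡.cong (λ r → r * q * q + t) (repunit-suc j)

    repdigit-expand : ∀ x j → wordVal q (rep x (suc (suc j))) ≡ x * ((repunit q j * q + 1) * q + 1)
    repdigit-expand x j = ≡.trans (repdigit-value q x (suc (suc j)))
      (≡.cong (x *_) (≡.trans (repunit-suc (suc j)) (≡.cong (λ r → r * q + 1) (repunit-suc j))))

    excess-low : ∀ j t → excess j t ≡ (s * repunit q j * q + s-1) * q + (s + t)
    excess-low j t = ≡.trans
      (≡.cong₂ _∸_ (≡.trans (ones00-expand j t) (split-low q sbar s s-1 (repunit q j) t s≡1+[s-1] q≡sbar+s))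
                   (repdigit-expand sbar j))
      (ℕ.m+n∸m≡n (sbar * ((repunit q j * q + 1) * q + 1)) _)

    excess-high : ∀ j u → excess j (sbar + u) ≡ s * (repunit q j * q + 1) * q + u
    excess-high j u = ≡.trans
      (≡.cong₂ _∸_ (≡.trans (ones00-expand j (sbar + u)) (split-high q sbar s (repunit q j) u q≡sbar+s))
                   (repdigit-expand sbar j))
      (ℕ.m+n∸m≡n (sbar * ((repunit q j * q + 1) * q + 1)) _)

    lucas-q : ∀ A a B b → a < q → b < q → binom (A * q + a) (B * q + b) ≈ binom A B · binom a b
    lucas-q = lucas (vanish-pow e)

    -- For t < sbar the top word is (N+1)·q + s and the excess is N·q + (s + t)
    -- with N ≡ s - 1 mod q, giving s·C(s, s + t): s for t = 0, else 0.
    binom-low : ∀ j t → t < sbar → binom (top j) (excess j t) ≈ natF F s · binom s (s + t)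
    binom-low j t t<sbar = begin
      binom (top j) (excess j t)
        ≈⟨ binom-≡ (≡.trans (repdigit-expand s j) (top-digits-low q s s-1 X s≡1+[s-1])) (excess-low j t) ⟩
      binom (suc N * q + s) (N * q + (s + t))
        ≈⟨ lucas-q (suc N) s N (s + t) s<q s+t<q ⟩
      binom (suc N) N · binom s (s + t)
        ≈⟨ *-congʳ (reflexive (≡.cong (natF F) (C-suc-self N))) ⟩
      natF F (suc N) · binom s (s + t)
        ≈⟨ *-congʳ (trans (reflexive (≡.cong (natF F) last-digit)) (natF-last-digit (s * X) s)) ⟩
      natF F s · binom s (s + t)
        ∎
      where
      X : ℕ
      X = repunit q j
      N : ℕ
      N = s * X * q + s-1
      s+t<q : s + t < q
      s+t<q = ℕ.<-≤-trans (ℕ.+-monoʳ-< s t<sbar) (ℕ.≤-reflexive (≡.trans (ℕ.+-comm s sbar) (≡.sym q≡sbar+s)))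
      last-digit : suc N ≡ s * X * q + s
      last-digit = ≡.trans (≡.sym (ℕ.+-suc (s * X * q) s-1)) (≡.cong (s * X * q +_) (≡.sym s≡1+[s-1]))

    -- For t = sbar + u the top word is W·q + s and the excess is W·q + u,
    -- where W = s·[1^(j+1)]_q; so only C(s, u) survives.
    binom-high : ∀ j u → u ≤ s → binom (top j) (excess j (sbar + u)) ≈ binom s u
    binom-high j u u≤s = begin
      binom (top j) (excess j (sbar + u))
        ≈⟨ binom-≡ (≡.trans (repdigit-expand s j) (top-digits-high q s X)) (excess-high j u) ⟩
      binom (W * q + s) (W * q + u)
        ≈⟨ lucas-q W s W u s<q (ℕ.≤-<-trans u≤s s<q) ⟩
      binom W W · binom s u
        ≈⟨ *-congʳ (binom-diag W) ⟩
      1# · binom s u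
        ≈⟨ *-identityˡ _ ⟩
      binom s u
        ∎
      where
      X : ℕ
      X = repunit q j
      W : ℕ
      W = s * (X * q + 1)

    -- The power of -a: by x^q = x the exponent collapses to its digit sum.
    exponent-low : ∀ j → pow (- a) (excess j 0) ≈ pow (- a) (s-1 + suc j * s)
    exponent-low j = begin
      pow (- a) (excess j 0)                       ≡⟨ ≡.cong (pow (- a)) (excess-low j 0) ⟩
      pow (- a) ((s * X * q + s-1) * q + (s + 0))  ≈⟨ pow-digits (- a) (s * X * q + s-1) (s + 0) ⟩
      pow (- a) ((s * X * q + s-1) + (s + 0))      ≡⟨ ≡.cong (pow (- a)) (regroup (s * X) q s-1 s) ⟩
      pow (- a) (s * X * q + (s-1 + (s + 0)))      ≈⟨ pow-digits (- a) (s * X) (s-1 + (s + 0)) ⟩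
      pow (- a) (s * X + (s-1 + (s + 0)))          ≈⟨ pow-repunit (- a) s j _ ⟩
      pow (- a) (s * j + (s-1 + (s + 0)))          ≡⟨ ≡.cong (pow (- a)) (collect s j s-1) ⟩
      pow (- a) (s-1 + suc j * s)                  ∎
      where
      X : ℕ
      X = repunit q j
      regroup : ∀ y q s-1 s → (y * q + s-1) + (s + 0) ≡ y * q + (s-1 + (s + 0))
      regroup = solve-∀
      collect : ∀ s j s-1 → s * j + (s-1 + (s + 0)) ≡ s-1 + suc j * s
      collect = solve-∀

    exponent-high : ∀ j u → pow (- a) (excess j (sbar + u)) ≈ pow (- a) (u + suc j * s)
    exponent-high j u = begin
      pow (- a) (excess j (sbar + u))        ≡⟨ ≡.cong (pow (- a)) (excess-high j u) ⟩
      pow (- a) (s * (X * q + 1) * q + u)    ≈⟨ pow-digits (- a) (s * (X * q + 1)) u ⟩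
      pow (- a) (s * (X * q + 1) + u)        ≡⟨ ≡.cong (λ r → pow (- a) (s * r + u)) (repunit-suc j) ⟨
      pow (- a) (s * repunit q (suc j) + u)  ≈⟨ pow-repunit (- a) s (suc j) u ⟩
      pow (- a) (s * suc j + u)              ≡⟨ ≡.cong (pow (- a)) (swap s j u) ⟩
      pow (- a) (u + suc j * s)              ∎
      where
      X : ℕ
      X = repunit q j
      swap : ∀ s j u → s * suc j + u ≡ u + suc j * s
      swap = solve-∀

    C-s-[s-1] : s C s-1 ≡ s
    C-s-[s-1] = ≡.subst (λ s′ → s′ C s-1 ≡ s′) (≡.sym s≡1+[s-1]) (C-suc-self s-1)

    binom-s-s : ∀ {t} → t ≡ s → binom s t ≈ 1#
    binom-s-s ≡.refl = binom-diag s

    d-ones00-0 : ∀ {m n} j → bjmn q 2 m n ≡ just (ones00 q (suc j) 0) →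
                 d m n ≈ natF F (s C s-1) · pow (- a) (s-1 + suc j * s) · pow -1ᶠ (s-1 * j) · pow -1ᶠ (n ∸ 1)
    d-ones00-0 {m} {n} j term = trans (d-window {m} {n} term (k-ones00 j 0 z≤n))
      (*-congʳ (*-cong (*-cong leading (exponent-low j)) (sign-window j)))
      where
      leading : binom (top j) (excess j 0) ≈ natF F (s C s-1)
      leading = begin
        binom (top j) (excess j 0)  ≈⟨ binom-low j 0 1≤sbar ⟩
        natF F s · binom s (s + 0)  ≈⟨ *-congˡ (binom-s-s (ℕ.+-identityʳ s)) ⟩
        natF F s · 1#               ≈⟨ *-identityʳ _ ⟩
        natF F s                    ≈⟨ reflexive (≡.cong (natF F) C-s-[s-1]) ⟨
        natF F (s C s-1)            ∎

    -- b = [1^(j+1) 0 0]_q + t with 1 ≤ t < sbar: the binomial coefficient vanishes.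
    d-ones00-low : ∀ {m n} j t → 1 ≤ t → t < sbar → bjmn q 2 m n ≡ just (ones00 q (suc j) t) → d m n ≈ 0#
    d-ones00-low {m} {n} j t 1≤t t<sbar term =
      trans (d-window {m} {n} term (k-ones00 j t (ℕ.<⇒≤ (ℕ.<-trans t<sbar sbar<q))))
      (zero-leading (trans (binom-low j t t<sbar) (trans (*-congˡ (binom-above (ℕ.m<m+n s 1≤t))) (zeroʳ _))))
      where
      zero-leading : ∀ {x y z w} → x ≈ 0# → x · y · z · w ≈ 0#
      zero-leading x≈0 = trans (*-congʳ (trans (*-congʳ (trans (*-congʳ x≈0) (zeroˡ _))) (zeroˡ _))) (zeroˡ _)

    d-ones00-high : ∀ {m n} j u → u ≤ s → bjmn q 2 m n ≡ just (ones00 q (suc j) (sbar + u)) →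
                    d m n ≈ binom s u · pow (- a) (u + suc j * s) · pow -1ᶠ (s-1 * j) · pow -1ᶠ (n ∸ 1)
    d-ones00-high {m} {n} j u u≤s term = trans (d-window {m} {n} term (k-ones00 j (sbar + u) sbar+u≤q))
      (*-congʳ (*-cong (*-cong (binom-high j u u≤s) (exponent-high j u)) (sign-window j)))
      where
      sbar+u≤q : sbar + u ≤ q
      sbar+u≤q = ℕ.≤-trans (ℕ.+-monoʳ-≤ sbar u≤s) (ℕ.≤-reflexive (≡.sym q≡sbar+s))

    d-small : ∀ {m n} t → 1 ≤ t → sbar ≤ t → t ≤ q → bjmn q 2 m n ≡ just t →
              d m n ≈ binom s (t ∸ sbar) · pow (- a) (t ∸ sbar) · pow -1ᶠ (1 * s-1) · pow -1ᶠ (n ∸ 1)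
    d-small {m} {n} t 1≤t sbar≤t t≤q term = d-window {m} {n} term (k-small t 1≤t sbar≤t t≤q)

    d-zero : ∀ {m n} → bjmn q 2 m n ≡ just 0 →
             d m n ≈ binom 0 0 · pow (- a) 0 · pow -1ᶠ (0 * s-1) · pow -1ᶠ (n ∸ 1)
    d-zero {m} {n} term = d-window {m} {n} term ≡.refl

    value-≡ : ∀ {x y E E′ S S′ N} → x ≈ y → E ≡ E′ → S ≡ S′ →
              x · pow (- a) E · pow -1ᶠ S · pow -1ᶠ N ≈ y · pow (- a) E′ · pow -1ᶠ S′ · pow -1ᶠ N
    value-≡ x≈y ≡.refl ≡.refl = *-congʳ (*-congʳ (*-congʳ x≈y))

    drop-unit : ∀ {x y y′ z z′ w} → x ≈ 1# → y ≈ y′ → z ≈ z′ → x · y · z · w ≈ y′ · z′ · w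
    drop-unit x≈1 y≈y′ z≈z′ = *-congʳ (*-cong (trans (*-congʳ x≈1) (trans (*-identityˡ _) y≈y′)) z≈z′)

    <⇒≤∸1 : ∀ {i} → i < q → i ≤ q ∸ 1
    <⇒≤∸1 i<q = ℕ.≤-trans (ℕ.<⇒≤pred i<q) (ℕ.≤-reflexive (ℕ.pred[m∸n]≡m∸[1+n] q 0))

    sbar≤q-1 : sbar ≤ q ∸ 1
    sbar≤q-1 = ℕ.∸-monoʳ-≤ q (ℕ.<⇒≤ 1<s)

    ∣n-1+n∣≡1 : ∀ n → ∣ n - suc n ∣ ≡ 1
    ∣n-1+n∣≡1 n = ≡.trans (ℕ.m≤n⇒∣m-n∣≡n∸m (ℕ.n≤1+n n)) (ℕ.m+n∸n≡m 1 n)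

    q+1≡1+q : q + 1 ≡ suc q
    q+1≡1+q = ℕ.+-comm q 1

    1+[q-1]≡q : suc (q ∸ 1) ≡ q
    1+[q-1]≡q = ℕ.suc-pred q {{ℕ.>-nonZero (ℕ.<-trans z<s 2≤q)}}

    sbar+1≤1+n⇒sbar≤n : ∀ {n} → sbar + 1 ≤ suc n → sbar ≤ n
    sbar+1≤1+n⇒sbar≤n sbar<n = ℕ.s≤s⁻¹ (ℕ.≤-trans (ℕ.≤-reflexive (ℕ.+-comm 1 sbar)) sbar<n)

    -- n = 1: b_{2,m,1} = [1^m 0 0]_q itself, in window m + 1.
    case-first : ∀ m → 1 ≤ m →
      d m 1 ≈ natF F (s C (s ∸ 1)) · pow (- a) ((s ∸ 1) + (m + 1 ∸ 1) * s)
              · pow -1ᶠ ((s ∸ 1) * ∣ m - 1 ∣) · pow -1ᶠ (1 ∸ 1)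
    case-first (suc j) _ = trans (d-ones00-0 {suc j} {1} j (Trajectory.term (suc j) 0 z≤n z≤n))
      (value-≡ {N = 0} refl (≡.cong (λ k → s-1 + k * s) (≡.sym (ℕ.m+n∸n≡m (suc j) 1)))
                    (≡.cong (s-1 *_) (≡.sym (ℕ.m≤n⇒∣n-m∣≡n∸m (s≤s (z≤n {j}))))))

    -- 2 ≤ n ≤ sbar: the excess has last digit s + t with 1 ≤ t < sbar, so
    -- C(s, s + t) = 0; or the term is a digit below sbar (no window); or the
    -- procedure has stopped.
    case-low : ∀ m n → 1 ≤ m → 2 ≤ n → n ≤ sbar → d m n ≈ 0#
    case-low m (suc i) _ (s≤s 1≤i) i<sbar with ℕ.<-cmp i m
    ... | tri< i<m _ _ = d-ones00-low {m} {suc i} (m ∸ suc i) i 1≤i i<sbar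
                           (Trajectory.term-before m i i<m (ℕ.<⇒≤ (ℕ.<-trans i<sbar sbar<q)))
    ... | tri≈ _ ≡.refl _ = d-outside {i} {suc i} (Trajectory.term-last i (ℕ.<⇒≤ (ℕ.<-trans i<sbar sbar<q)))
                                                  (k-none i 1≤i i<sbar)
    ... | tri> _ _ m<i = d-stopped {m} {suc i}
                           (Trajectory.stops-after m (Trajectory.stop-early m m<q-1) m<i)
      where
      m<q-1 : m < q ∸ 1
      m<q-1 = ℕ.<-≤-trans (ℕ.<-trans m<i i<sbar) sbar≤q-1

    -- sbar < n ≤ q and m < n - 1: the procedure stopped right after reaching m.
    case-gap : ∀ m n → 1 ≤ m → sbar + 1 ≤ n → n ≤ q → m < n ∸ 1 → d m n ≈ 0#
    case-gap m (suc i) _ _ n≤q m<i = d-stopped {m} {suc i}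
      (Trajectory.stops-after m (Trajectory.stop-early m (ℕ.<-≤-trans m<i (<⇒≤∸1 n≤q))) m<i)

    value-high : ℕ → ℕ → Carrier
    value-high m n = natF F (s C (n ∸ 1 ∸ sbar)) · pow (- a) ((n ∸ 1 ∸ sbar) + (m + 1 ∸ n) * s)
                     · pow -1ᶠ ((s ∸ 1) * ∣ m - n ∣) · pow -1ᶠ (n ∸ 1)

    -- n = m + 1: the term is m itself, in window 1.
    value-high-diagonal : ∀ i → 1 ≤ i → sbar ≤ i → i < q → d i (suc i) ≈ value-high i (suc i)
    value-high-diagonal i 1≤i sbar≤i i<q =
      trans (d-small {i} {suc i} i 1≤i sbar≤i (ℕ.<⇒≤ i<q) (Trajectory.term-last i (ℕ.<⇒≤ i<q)))
            (value-≡ {N = i} refl exponent sign)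
      where
      exponent : i ∸ sbar ≡ (i ∸ sbar) + (i + 1 ∸ suc i) * s
      exponent = ≡.sym (≡.trans (≡.cong (λ k → (i ∸ sbar) + k * s) (≡.trans (≡.cong (_∸ suc i) (ℕ.+-comm i 1)) (ℕ.n∸n≡0 i)))
                                (ℕ.+-identityʳ _))
      sign : 1 * s-1 ≡ s-1 * ∣ i - suc i ∣
      sign = ≡.trans (ℕ.*-comm 1 s-1) (≡.cong (s-1 *_) (≡.sym (∣n-1+n∣≡1 i)))

    -- n ≤ m: the term is [1^(j+1) 0 0]_q + (sbar + u) with j = m - n, u = n - 1 - sbar.
    value-high-below : ∀ m i → sbar ≤ i → i < q → i < m → d m (suc i) ≈ value-high m (suc i)
    value-high-below m i sbar≤i i<q i<m =
      trans (d-ones00-high {m} {suc i} j u u≤s term) (value-≡ {N = i} refl exponent sign)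
      where
      j : ℕ
      j = m ∸ suc i
      u : ℕ
      u = i ∸ sbar
      u≤s : u ≤ s
      u≤s = ℕ.≤-trans (ℕ.∸-monoˡ-≤ sbar (ℕ.≤-trans (ℕ.<⇒≤ i<q) (ℕ.≤-reflexive q≡sbar+s)))
                      (ℕ.≤-reflexive (ℕ.m+n∸m≡n sbar s))
      term : bjmn q 2 m (suc i) ≡ just (ones00 q (suc j) (sbar + u))
      term = ≡.trans (Trajectory.term-before m i i<m (ℕ.<⇒≤ i<q))
                     (≡.cong (λ t → just (ones00 q (suc j) t)) (≡.sym (ℕ.m+[n∸m]≡n sbar≤i)))
      exponent : u + suc j * s ≡ u + (m + 1 ∸ suc i) * s
      exponent = ≡.cong (λ k → u + k * s) (≡.sym (≡.trans (≡.cong (_∸ suc i) (ℕ.+-comm m 1)) (m∸n≡suc[m∸1+n] i<m)))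
      sign : s-1 * j ≡ s-1 * ∣ m - suc i ∣
      sign = ≡.cong (s-1 *_) (≡.sym (ℕ.m≤n⇒∣n-m∣≡n∸m i<m))

    case-high : ∀ m n → 1 ≤ m → sbar + 1 ≤ n → n ≤ q → n ∸ 1 ≤ m → d m n ≈ value-high m n
    case-high m zero _ sbar<0 _ _ = ⊥-elim (ℕ.n≮0 (ℕ.<-≤-trans (ℕ.m<m+n sbar z<s) sbar<0))
    case-high m (suc i) 1≤m sbar<n n≤q i≤m with ℕ.m≤n⇒m<n∨m≡n i≤m
    ... | inj₂ ≡.refl = value-high-diagonal i 1≤m (sbar+1≤1+n⇒sbar≤n sbar<n) n≤q
    ... | inj₁ i<m    = value-high-below m i (sbar+1≤1+n⇒sbar≤n sbar<n) n≤q i<m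

    case-q+1-early : ∀ m → 1 ≤ m → m < (q + 1) ∸ 2 → d m (q + 1) ≈ 0#
    case-q+1-early m _ m<q-1 rewrite q+1≡1+q = d-stopped {m} {suc q}
      (Trajectory.stops-after m (Trajectory.stop-early m m<q-1) (ℕ.<-≤-trans m<q-1 (ℕ.m∸n≤m q 1)))

    value-q+1 : ℕ → Carrier
    value-q+1 m = pow (- a) ((m + 2 ∸ suc q) * s) · pow -1ᶠ (s-1 * ∣ m - suc q ∣) · pow -1ᶠ q

    -- m = q - 1: the procedure reaches 0, in window 0.
    value-q+1-reaching-zero : ∀ m → m ≡ q ∸ 1 → d m (suc q) ≈ value-q+1 m
    value-q+1-reaching-zero m m≡q-1 =
      trans (d-zero {m} {suc q} term) (drop-unit natF-1 (reflexive (≡.cong (pow (- a)) exponent)) sign)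
      where
      1+m≡q : suc m ≡ q
      1+m≡q = ≡.trans (≡.cong suc m≡q-1) 1+[q-1]≡q
      term : bjmn q 2 m (suc q) ≡ just 0
      term = ≡.subst (λ k → bjmn q 2 m (suc k) ≡ just 0) 1+m≡q (Trajectory.reach-zero m m≡q-1)
      exponent : 0 ≡ (m + 2 ∸ suc q) * s
      exponent = ≡.cong (_* s) (≡.sym (≡.trans (≡.cong (_∸ suc q) (≡.trans (ℕ.+-comm m 2) (≡.cong suc 1+m≡q)))
                                               (ℕ.n∸n≡0 (suc q))))
      distance : ∣ m - suc q ∣ ≡ 2
      distance = ≡.trans (ℕ.m≤n⇒∣m-n∣≡n∸m (ℕ.≤-trans (ℕ.n≤1+n m) (ℕ.≤-trans (ℕ.≤-reflexive 1+m≡q) (ℕ.n≤1+n q))))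
                         (≡.trans (≡.cong (λ k → suc k ∸ m) (≡.sym 1+m≡q)) (ℕ.m+n∸n≡m 2 m))
      double : ∀ x → x * 2 ≡ 2 * x + 0
      double = solve-∀
      sign : pow -1ᶠ (0 * s-1) ≈ pow -1ᶠ (s-1 * ∣ m - suc q ∣)
      sign = sym (trans (reflexive (≡.cong (pow -1ᶠ) (≡.trans (≡.cong (s-1 *_) distance) (double s-1))))
                        (sign-even s-1 0))

    -- m = q: the term is q itself, in window 1.
    value-q+1-at-q : d q (suc q) ≈ value-q+1 q
    value-q+1-at-q = trans (d-small {q} {suc q} q (ℕ.≤-trans (s≤s z≤n) 2≤q) (ℕ.m∸n≤m q s) ℕ.≤-refl
                                    (Trajectory.term-last q ℕ.≤-refl))
      (drop-unit (binom-s-s q∸sbar≡s) (reflexive (≡.cong (pow (- a)) exponent)) (reflexive (≡.cong (pow -1ᶠ) sign)))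
      where
      q∸sbar≡s : q ∸ sbar ≡ s
      q∸sbar≡s = ℕ.m∸[m∸n]≡n (ℕ.<⇒≤ s<q)
      exponent : q ∸ sbar ≡ (q + 2 ∸ suc q) * s
      exponent = ≡.trans q∸sbar≡s (≡.sym (≡.trans (≡.cong (λ k → (k ∸ suc q) * s) (ℕ.+-comm q 2))
                                                   (≡.trans (≡.cong (_* s) (ℕ.m+n∸n≡m 1 (suc q))) (ℕ.+-identityʳ s))))
      sign : 1 * s-1 ≡ s-1 * ∣ q - suc q ∣
      sign = ≡.trans (ℕ.*-comm 1 s-1) (≡.cong (s-1 *_) (≡.sym (∣n-1+n∣≡1 q)))

    -- m > q: the term is [1^(j+1) 0 0]_q + q with j = m - q - 1, in window j + 2.
    value-q+1-beyond-q : ∀ m → q < m → d m (suc q) ≈ value-q+1 m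
    value-q+1-beyond-q m q<m = trans (d-ones00-high {m} {suc q} j s ℕ.≤-refl term)
      (drop-unit (binom-diag s) (reflexive (≡.cong (pow (- a)) exponent)) (reflexive (≡.cong (pow -1ᶠ) sign)))
      where
      j : ℕ
      j = m ∸ suc q
      term : bjmn q 2 m (suc q) ≡ just (ones00 q (suc j) (sbar + s))
      term = ≡.trans (Trajectory.term-before m q q<m ℕ.≤-refl) (≡.cong (λ t → just (ones00 q (suc j) t)) q≡sbar+s)
      exponent : s + suc j * s ≡ (m + 2 ∸ suc q) * s
      exponent = ≡.cong (_* s) (≡.sym (≡.trans (≡.cong (_∸ suc q) (ℕ.+-comm m 2))
                                               (≡.trans (ℕ.+-∸-assoc 1 (ℕ.<⇒≤ q<m)) (≡.cong suc (m∸n≡suc[m∸1+n] q<m)))))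
      sign : s-1 * j ≡ s-1 * ∣ m - suc q ∣
      sign = ≡.cong (s-1 *_) (≡.sym (ℕ.m≤n⇒∣n-m∣≡n∸m q<m))

    case-q+1 : ∀ m → 1 ≤ m → (q + 1) ∸ 2 ≤ m →
      d m (q + 1) ≈ pow (- a) ((m + 2 ∸ (q + 1)) * s) · pow -1ᶠ ((s ∸ 1) * ∣ m - (q + 1) ∣)
                    · pow -1ᶠ ((q + 1) ∸ 1)
    case-q+1 m _ q-1≤m rewrite q+1≡1+q with ℕ.<-cmp m q
    ... | tri< m<q _ _    = value-q+1-reaching-zero m (ℕ.≤-antisym (<⇒≤∸1 m<q) q-1≤m)
    ... | tri≈ _ ≡.refl _ = value-q+1-at-q
    ... | tri> _ _ q<m    = value-q+1-beyond-q m q<m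

    -- n > q + 1: the procedure always stops by step q + 1.
    case-beyond : ∀ m n → 1 ≤ m → q + 1 < n → d m n ≈ 0#
    case-beyond m (suc i) _ q+1<n with ℕ.<-cmp m (q ∸ 1)
    ... | tri< m<q-1 _ _ = d-stopped {m} {suc i}
      (Trajectory.stops-after m (Trajectory.stop-early m m<q-1) (ℕ.<-≤-trans m<q-1 (ℕ.≤-trans (ℕ.m∸n≤m q 1) q≤i)))
      where
      q≤i : q ≤ i
      q≤i = ℕ.≤-trans (ℕ.m≤m+n q 1) (ℕ.s≤s⁻¹ q+1<n)
    ... | tri≈ _ m≡q-1 _ = d-stopped {m} {suc i}
      (Trajectory.stops-after m (Trajectory.stop-after-zero m m≡q-1) 2+m≤i)
      where
      2+m≤i : suc (suc m) ≤ i
      2+m≤i = ℕ.≤-trans (ℕ.≤-reflexive (≡.trans (≡.cong (λ k → suc (suc k)) m≡q-1)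
                          (≡.trans (≡.cong suc 1+[q-1]≡q) (≡.sym q+1≡1+q))))
                        (ℕ.s≤s⁻¹ q+1<n)
    ... | tri> _ _ q-1<m = d-stopped {m} {suc i}
      (Trajectory.stops-after m (Trajectory.stop-late m q≤m) 1+q≤i)
      where
      q≤m : q ≤ m
      q≤m = ℕ.≤-trans (ℕ.≤-reflexive (≡.sym 1+[q-1]≡q)) q-1<m
      1+q≤i : suc q ≤ i
      1+q≤i = ℕ.≤-trans (ℕ.≤-reflexive (≡.sym q+1≡1+q)) (ℕ.s≤s⁻¹ q+1<n)

lemma7 : ∀ {c ℓ : Level} (F : CommutativeRing c ℓ) (p e : ℕ) → Prime p → 1 ≤ e →
  IsFiniteFieldOfOrder F (p ^ e) →
  CommutativeRing._≈_ F (natF F p) (CommutativeRing.0# F) →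
  (a : CommutativeRing.Carrier F) (s : ℕ) → 1 < s → s < p ^ e →
  let open FieldNotation F
      q = p ^ e
      sbar = q ∸ s
      d = dF F q s a 2
      -1ᶠ = minusOne F
  in
  (∀ m → 1 ≤ m →
     d m 1 ≃ natF F (s C (s ∸ 1)) · powF F (negᶠ a) ((s ∸ 1) + (m + 1 ∸ 1) * s)
               · powF F -1ᶠ ((s ∸ 1) * ∣ m - 1 ∣) · powF F -1ᶠ (1 ∸ 1))
  × (∀ m n → 1 ≤ m → 2 ≤ n → n ≤ sbar → d m n ≃ 0ᶠ)
  × (∀ m n → 1 ≤ m → sbar + 1 ≤ n → n ≤ q → m < n ∸ 1 → d m n ≃ 0ᶠ)
  × (∀ m n → 1 ≤ m → sbar + 1 ≤ n → n ≤ q → n ∸ 1 ≤ m →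
       d m n ≃ natF F (s C (n ∸ 1 ∸ sbar))
                 · powF F (negᶠ a) ((n ∸ 1 ∸ sbar) + (m + 1 ∸ n) * s)
                 · powF F -1ᶠ ((s ∸ 1) * ∣ m - n ∣) · powF F -1ᶠ (n ∸ 1))
  × (∀ m → 1 ≤ m → m < (q + 1) ∸ 2 → d m (q + 1) ≃ 0ᶠ)
  × (∀ m → 1 ≤ m → (q + 1) ∸ 2 ≤ m →
       d m (q + 1) ≃ powF F (negᶠ a) ((m + 2 ∸ (q + 1)) * s)
                       · powF F -1ᶠ ((s ∸ 1) * ∣ m - (q + 1) ∣)
                       · powF F -1ᶠ ((q + 1) ∸ 1))
  × (∀ m n → 1 ≤ m → q + 1 < n → d m n ≃ 0ᶠ)
lemma7 F p e p-prime 1≤e finite p≈0 a s 1<s s<q =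
  case-first , case-low , case-gap , case-high , case-q+1-early , case-q+1 , case-beyond
  where open Evaluation.Values F p e p-prime 1≤e finite p≈0 a s 1<s s<q
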